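{- Let $U$ be any consistent theory in the language of arithmetic that extends Robinson's theory $\mathsf R$ (no restriction on the complexity of its axiom set). Then there is no formula $\rho(x)$ (of any complexity) such that for all sentences $\varphi,\psi$ both of the following hold: (Independence) if $U+\varphi$ is consistent, then so are $U+\varphi+\rho(\ulcorner\varphi\urcorner)$ and $U+\varphi+\neg\rho(\ulcorner\varphi\urcorner)$; (Extensionality) if $U\vdash\varphi\leftrightarrow\psi$, then $U\vdash\rho(\ulcorner\varphi\urcorner)\leftrightarrow\rho(\ulcorner\psi\urcorner)$.
   Context: $\mathsf R$ is the Tarski–Mostowski–Robinson theory $\mathsf R$. $\ulcorner\varphi\urcorner$ is the numeral of the Gödel number of $\varphi$. -}

module Defs where

open import Data.Nat using (ℕ; zero; suc; _+_; _*_)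
open import Data.Fin using (Fin; toℕ) renaming (zero to fz; suc to fs)
open import Data.Product using (_×_)
open import Data.Sum using (_⊎_)
open import Relation.Binary.PropositionalEquality using (_≡_; _≢_)
open import Relation.Nullary using (¬_)

-- Language of arithmetic {0, S, +, ×, ≤}, well-scoped de Bruijn syntax.
-- Term n / Formula n : at most n free variables (var fz = innermost).

infixl 7 _*'_
infixl 6 _+'_
infix  4 _≐_ _≤'_
infixr 2 _⇒_

data Term (n : ℕ) : Set where
  var   : Fin n → Term n
  zero' : Term n
  suc'  : Term n → Term n
  _+'_  : Term n → Term n → Term n
  _*'_  : Term n → Term n → Term n

data Formula (n : ℕ) : Set where
  _≐_  : Term n → Term n → Formula n
  _≤'_ : Term n → Term n → Formula n
  ⊥'   : Formula n
  _⇒_  : Formula n → Formula n → Formula n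
  ∀'   : Formula (suc n) → Formula n

Sentence : Set
Sentence = Formula 0

¬' : ∀ {n} → Formula n → Formula n
¬' φ = φ ⇒ ⊥'

infixl 3 _∨'_ _∧'_
infix  2 _⇔_

_∨'_ : ∀ {n} → Formula n → Formula n → Formula n
φ ∨' ψ = ¬' φ ⇒ ψ

_∧'_ : ∀ {n} → Formula n → Formula n → Formula n
φ ∧' ψ = ¬' (φ ⇒ ¬' ψ)

_⇔_ : ∀ {n} → Formula n → Formula n → Formula n
φ ⇔ ψ = (φ ⇒ ψ) ∧' (ψ ⇒ φ)

liftRen : ∀ {m n} → (Fin m → Fin n) → Fin (suc m) → Fin (suc n)
liftRen ρ fz     = fz
liftRen ρ (fs i) = fs (ρ i)

renT : ∀ {m n} → (Fin m → Fin n) → Term m → Term n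
renT ρ (var i)  = var (ρ i)
renT ρ zero'    = zero'
renT ρ (suc' t) = suc' (renT ρ t)
renT ρ (t +' s) = renT ρ t +' renT ρ s
renT ρ (t *' s) = renT ρ t *' renT ρ s

ren : ∀ {m n} → (Fin m → Fin n) → Formula m → Formula n
ren ρ (t ≐ s)  = renT ρ t ≐ renT ρ s
ren ρ (t ≤' s) = renT ρ t ≤' renT ρ s
ren ρ ⊥'       = ⊥'
ren ρ (φ ⇒ ψ)  = ren ρ φ ⇒ ren ρ ψ
ren ρ (∀' φ)   = ∀' (ren (liftRen ρ) φ)

liftSub : ∀ {m n} → (Fin m → Term n) → Fin (suc m) → Term (suc n)
liftSub σ fz     = var fz
liftSub σ (fs i) = renT fs (σ i)

subT : ∀ {m n} → (Fin m → Term n) → Term m → Term n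
subT σ (var i)  = σ i
subT σ zero'    = zero'
subT σ (suc' t) = suc' (subT σ t)
subT σ (t +' s) = subT σ t +' subT σ s
subT σ (t *' s) = subT σ t *' subT σ s

sub : ∀ {m n} → (Fin m → Term n) → Formula m → Formula n
sub σ (t ≐ s)  = subT σ t ≐ subT σ s
sub σ (t ≤' s) = subT σ t ≤' subT σ s
sub σ ⊥'       = ⊥'
sub σ (φ ⇒ ψ)  = sub σ φ ⇒ sub σ ψ
sub σ (∀' φ)   = ∀' (sub (liftSub σ) φ)

single : ∀ {n} → Term n → Fin (suc n) → Term n
single t fz     = t
single t (fs i) = var i

_[_] : ∀ {n} → Formula (suc n) → Term n → Formula n
φ [ t ] = sub (single t) φ

wk : ∀ {n} → Formula n → Formula (suc n)
wk = ren fs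

embed : ∀ {n} → Sentence → Formula n
embed = ren noVar
  where
  noVar : ∀ {n} → Fin 0 → Fin n
  noVar ()

num : ∀ {n} → ℕ → Term n
num zero    = zero'
num (suc k) = suc' (num k)

-- A theory is an arbitrary set of sentences (no definability restriction).
Theory : Set₁
Theory = Sentence → Set

infixl 5 _⊕_
_⊕_ : Theory → Sentence → Theory
(T ⊕ φ) ψ = T ψ ⊎ ψ ≡ φ

infix 1 _⊢_
data _⊢_ (T : Theory) : {n : ℕ} → Formula n → Set where
  ax   : ∀ {n} {φ : Sentence} → T φ → T ⊢ embed {n} φ
  A1   : ∀ {n} {φ ψ : Formula n} → T ⊢ φ ⇒ ψ ⇒ φ
  A2   : ∀ {n} {φ ψ χ : Formula n} → T ⊢ (φ ⇒ ψ ⇒ χ) ⇒ (φ ⇒ ψ) ⇒ φ ⇒ χ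
  A3   : ∀ {n} {φ : Formula n} → T ⊢ ¬' (¬' φ) ⇒ φ
  Q1   : ∀ {n} {φ : Formula (suc n)} {t : Term n} → T ⊢ ∀' φ ⇒ φ [ t ]
  Q2   : ∀ {n} {ψ : Formula n} {φ : Formula (suc n)} →
         T ⊢ ∀' (wk ψ ⇒ φ) ⇒ ψ ⇒ ∀' φ
  E1   : ∀ {n} {t : Term n} → T ⊢ t ≐ t
  E2   : ∀ {n} {φ : Formula (suc n)} {t s : Term n} →
         T ⊢ t ≐ s ⇒ φ [ t ] ⇒ φ [ s ]
  mp   : ∀ {n} {φ ψ : Formula n} → T ⊢ φ ⇒ ψ → T ⊢ φ → T ⊢ ψ
  gen  : ∀ {n} {φ : Formula (suc n)} → T ⊢ φ → T ⊢ ∀' φ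

Consistent : Theory → Set
Consistent T = ¬ (T ⊢ ⊥' {0})

x₀ : Term 1
x₀ = var fz

upto : ℕ → Formula 1
upto zero    = x₀ ≐ num 0
upto (suc k) = upto k ∨' x₀ ≐ num (suc k)

data R : Theory where
  Ω1 : ∀ m k → R (num m +' num k ≐ num (m + k))
  Ω2 : ∀ m k → R (num m *' num k ≐ num (m * k))
  Ω3 : ∀ m k → m ≢ k → R (¬' (num m ≐ num k))
  Ω4 : ∀ k → R (∀' (x₀ ≤' num k ⇒ upto k))
  Ω5 : ∀ k → R (∀' (x₀ ≤' num k ∨' num k ≤' x₀))

Extends : Theory → Theory → Set
Extends U S = ∀ φ → S φ → U ⊢ φ

tri : ℕ → ℕ
tri zero    = zero
tri (suc k) = suc k + tri k

pair : ℕ → ℕ → ℕ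
pair a b = tri (a + b) + b

codeT : ∀ {n} → Term n → ℕ
codeT (var i)  = pair 0 (toℕ i)
codeT zero'    = pair 1 0
codeT (suc' t) = pair 2 (codeT t)
codeT (t +' s) = pair 3 (pair (codeT t) (codeT s))
codeT (t *' s) = pair 4 (pair (codeT t) (codeT s))

code : ∀ {n} → Formula n → ℕ
code (t ≐ s)  = pair 5 (pair (codeT t) (codeT s))
code (t ≤' s) = pair 6 (pair (codeT t) (codeT s))
code ⊥'       = pair 7 0
code (φ ⇒ ψ)  = pair 8 (pair (code φ) (code ψ))
code (∀' φ)   = pair 9 (code φ)

⌜_⌝ : Sentence → Term 0
⌜ φ ⌝ = num (code φ)

{-# OPTIONS --safe #-}
-- Let θ₁ ↔ ¬ρ(⌜θ₁⌝) and θ₂ ↔ ρ(⌜θ₂⌝) be fixed points in U. U + θ₁ proves ¬ρ(⌜θ₁⌝) and U + θ₂ proves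
-- ρ(⌜θ₂⌝), so by independence neither is consistent: U refutes θ₁ and θ₂. Hence U ⊢ θ₁ ↔ θ₂, and
-- extensionality turns ρ(⌜θ₁⌝), which follows from ¬θ₁, into ρ(⌜θ₂⌝) and so into θ₂: U is inconsistent.
--
-- The fixed points exist over R alone. R proves every true bounded (Δ₀) sentence, and "y is the code
-- of the fixed point built from x" is Δ₀ in y, x and a bound w on the witnesses, using Cantor pairing
-- and Gödel's β-function for the code of the numeral of x. R cannot prove that such a y is unique, so
-- the fixed point also asserts that every encoding with a smaller witness bound gives the same value;
-- comparing an arbitrary bound with the standard one then yields uniqueness in R.
module Submission where

open import Defs
open import Data.Nat using (ℕ; zero; suc; _+_; _*_; _∸_; _≤_; _<_; z≤n; s≤s; NonZero; _%_; _/_; _!)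
open import Data.Nat.Properties
  using ( _≟_; _≤?_; ≤-refl; ≤-trans; n≤1+n; m≤n⇒m≤1+n; <-irrefl; ≤∧≢⇒<; ≰⇒>; <⇒≱; m<1+n⇒m≤n
        ; m≤n⇒m<n∨m≡n; m≤m+n; m≤n+m; m≤n*m; +-comm; +-suc; +-cancelʳ-≡; *-comm; *-distribˡ-+
        ; *-cancelˡ-≡; m+[n∸m]≡n; _!≢0; module ≤-Reasoning )
open import Data.Nat.DivMod using ([m+kn]%n≡m%n; m<n⇒m%n≡m; %-remove-+ʳ; m≡m%n+[m/n]*n; m%n<n; m/n≤m; m%n≤m)
open import Data.Nat.Divisibility
  using (_∣_; ∣-refl; ∣-trans; ∣1⇒≡1; ∣m+n∣m⇒∣n; ∣n⇒∣m*n; ∣m⇒∣m*n; n∣m*n; m∣m*n; ∣⇒≤; m≤n⇒m!∣n!)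
open import Data.Nat.Coprimality using (Coprime; coprime-Bézout; coprime-divisor)
open import Data.Nat.GCD using (module Bézout)
open import Data.Nat.Tactic.RingSolver using (solve-∀)
open import Data.Fin using (Fin; #_) renaming (zero to fz; suc to fs)
open import Data.Product using (Σ; _×_; _,_; proj₁; proj₂; ∃-syntax)
open import Data.Sum using (_⊎_; inj₁; inj₂; swap)
open import Data.Empty using (⊥; ⊥-elim)
open import Data.Vec.Functional using (_∷_; [])
open import Function using (_∘_; id; const; case_of_)
open import Relation.Nullary using (¬_; yes; no)
open import Relation.Binary.PropositionalEquality
  using (_≡_; _≢_; refl; sym; trans; cong; cong₂; subst; subst₂; _≗_; module ≡-Reasoning)

private variable
  l m n : ℕ
  T T′ : Theory

subT-cong : {σ τ : Fin m → Term n} → σ ≗ τ → (t : Term m) → subT σ t ≡ subT τ t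
subT-cong eq (var i)  = eq i
subT-cong eq zero'    = refl
subT-cong eq (suc' t) = cong suc' (subT-cong eq t)
subT-cong eq (t +' s) = cong₂ _+'_ (subT-cong eq t) (subT-cong eq s)
subT-cong eq (t *' s) = cong₂ _*'_ (subT-cong eq t) (subT-cong eq s)

subT-subT : (σ : Fin m → Term n) (τ : Fin l → Term m) (t : Term l) →
            subT σ (subT τ t) ≡ subT (subT σ ∘ τ) t
subT-subT σ τ (var i)  = refl
subT-subT σ τ zero'    = refl
subT-subT σ τ (suc' t) = cong suc' (subT-subT σ τ t)
subT-subT σ τ (t +' s) = cong₂ _+'_ (subT-subT σ τ t) (subT-subT σ τ s)
subT-subT σ τ (t *' s) = cong₂ _*'_ (subT-subT σ τ t) (subT-subT σ τ s)

subT-var : (t : Term n) → subT var t ≡ t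
subT-var (var i)  = refl
subT-var zero'    = refl
subT-var (suc' t) = cong suc' (subT-var t)
subT-var (t +' s) = cong₂ _+'_ (subT-var t) (subT-var s)
subT-var (t *' s) = cong₂ _*'_ (subT-var t) (subT-var s)

renT≡subT : (ρ : Fin m → Fin n) (t : Term m) → renT ρ t ≡ subT (var ∘ ρ) t
renT≡subT ρ (var i)  = refl
renT≡subT ρ zero'    = refl
renT≡subT ρ (suc' t) = cong suc' (renT≡subT ρ t)
renT≡subT ρ (t +' s) = cong₂ _+'_ (renT≡subT ρ t) (renT≡subT ρ s)
renT≡subT ρ (t *' s) = cong₂ _*'_ (renT≡subT ρ t) (renT≡subT ρ s)

subT-num : (σ : Fin m → Term n) (k : ℕ) → subT σ (num k) ≡ num k
subT-num σ zero    = refl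
subT-num σ (suc k) = cong suc' (subT-num σ k)

renT-num : (ρ : Fin m → Fin n) (k : ℕ) → renT ρ (num k) ≡ num k
renT-num ρ k = trans (renT≡subT ρ (num k)) (subT-num (var ∘ ρ) k)

subT-liftSub-wk : (σ : Fin m → Term n) (t : Term m) →
                  subT (liftSub σ) (renT fs t) ≡ renT fs (subT σ t)
subT-liftSub-wk σ t = begin
  subT (liftSub σ) (renT fs t)          ≡⟨ cong (subT (liftSub σ)) (renT≡subT fs t) ⟩
  subT (liftSub σ) (subT (var ∘ fs) t)  ≡⟨ subT-subT (liftSub σ) (var ∘ fs) t ⟩
  subT (renT fs ∘ σ) t                  ≡⟨ subT-cong (λ i → renT≡subT fs (σ i)) t ⟩
  subT (subT (var ∘ fs) ∘ σ) t          ≡⟨ subT-subT (var ∘ fs) σ t ⟨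
  subT (var ∘ fs) (subT σ t)            ≡⟨ renT≡subT fs (subT σ t) ⟨
  renT fs (subT σ t)                    ∎
  where open ≡-Reasoning

subT-single-wk : (u : Term n) (t : Term n) → subT (single u) (renT fs t) ≡ t
subT-single-wk u t =
  trans (cong (subT (single u)) (renT≡subT fs t)) (trans (subT-subT (single u) (var ∘ fs) t) (subT-var t))

sub-cong : {σ τ : Fin m → Term n} → σ ≗ τ → (φ : Formula m) → sub σ φ ≡ sub τ φ
sub-cong eq (t ≐ s)  = cong₂ _≐_ (subT-cong eq t) (subT-cong eq s)
sub-cong eq (t ≤' s) = cong₂ _≤'_ (subT-cong eq t) (subT-cong eq s)
sub-cong eq ⊥'       = refl
sub-cong eq (φ ⇒ ψ)  = cong₂ _⇒_ (sub-cong eq φ) (sub-cong eq ψ)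
sub-cong eq (∀' φ)   = cong ∀' (sub-cong lift-eq φ)
  where
  lift-eq : liftSub _ ≗ liftSub _
  lift-eq fz     = refl
  lift-eq (fs i) = cong (renT fs) (eq i)

sub-sub : (σ : Fin m → Term n) (τ : Fin l → Term m) (φ : Formula l) →
          sub σ (sub τ φ) ≡ sub (subT σ ∘ τ) φ
sub-sub σ τ (t ≐ s)  = cong₂ _≐_ (subT-subT σ τ t) (subT-subT σ τ s)
sub-sub σ τ (t ≤' s) = cong₂ _≤'_ (subT-subT σ τ t) (subT-subT σ τ s)
sub-sub σ τ ⊥'       = refl
sub-sub σ τ (φ ⇒ ψ)  = cong₂ _⇒_ (sub-sub σ τ φ) (sub-sub σ τ ψ)
sub-sub σ τ (∀' φ)   = cong ∀' (trans (sub-sub (liftSub σ) (liftSub τ) φ) (sub-cong lift-eq φ))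
  where
  lift-eq : subT (liftSub σ) ∘ liftSub τ ≗ liftSub (subT σ ∘ τ)
  lift-eq fz     = refl
  lift-eq (fs i) = subT-liftSub-wk σ (τ i)

sub-var : (φ : Formula n) → sub var φ ≡ φ
sub-var (t ≐ s)  = cong₂ _≐_ (subT-var t) (subT-var s)
sub-var (t ≤' s) = cong₂ _≤'_ (subT-var t) (subT-var s)
sub-var ⊥'       = refl
sub-var (φ ⇒ ψ)  = cong₂ _⇒_ (sub-var φ) (sub-var ψ)
sub-var (∀' φ)   = cong ∀' (trans (sub-cong lift-var φ) (sub-var φ))
  where
  lift-var : liftSub var ≗ var
  lift-var fz     = refl
  lift-var (fs i) = refl

ren≡sub : (ρ : Fin m → Fin n) (φ : Formula m) → ren ρ φ ≡ sub (var ∘ ρ) φ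
ren≡sub ρ (t ≐ s)  = cong₂ _≐_ (renT≡subT ρ t) (renT≡subT ρ s)
ren≡sub ρ (t ≤' s) = cong₂ _≤'_ (renT≡subT ρ t) (renT≡subT ρ s)
ren≡sub ρ ⊥'       = refl
ren≡sub ρ (φ ⇒ ψ)  = cong₂ _⇒_ (ren≡sub ρ φ) (ren≡sub ρ ψ)
ren≡sub ρ (∀' φ)   = cong ∀' (trans (ren≡sub (liftRen ρ) φ) (sub-cong lift-eq φ))
  where
  lift-eq : var ∘ liftRen ρ ≗ liftSub (var ∘ ρ)
  lift-eq fz     = refl
  lift-eq (fs i) = refl

sub-ren : (σ : Fin m → Term n) (ρ : Fin l → Fin m) (φ : Formula l) →
          sub σ (ren ρ φ) ≡ sub (σ ∘ ρ) φ
sub-ren σ ρ φ = trans (cong (sub σ) (ren≡sub ρ φ)) (sub-sub σ (var ∘ ρ) φ)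

ren-sub : (ρ : Fin m → Fin n) (σ : Fin l → Term m) (φ : Formula l) →
          ren ρ (sub σ φ) ≡ sub (renT ρ ∘ σ) φ
ren-sub ρ σ φ = trans (ren≡sub ρ (sub σ φ))
  (trans (sub-sub (var ∘ ρ) σ φ) (sub-cong (λ i → sym (renT≡subT ρ (σ i))) φ))

sub-liftSub-single : (σ : Fin m → Term n) (t : Term n) (φ : Formula (suc m)) →
                     sub (liftSub σ) φ [ t ] ≡ sub (t ∷ σ) φ
sub-liftSub-single σ t φ = trans (sub-sub (single t) (liftSub σ) φ) (sub-cong eq φ)
  where
  eq : subT (single t) ∘ liftSub σ ≗ t ∷ σ
  eq fz     = refl
  eq (fs i) = subT-single-wk t (σ i)

embed≡sub : (φ : Sentence) → embed {n} φ ≡ sub (λ ()) φ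
embed≡sub φ = trans (ren≡sub _ φ) (sub-cong (λ ()) φ)

sub-embed : (σ : Fin m → Term n) (φ : Sentence) → sub σ (embed φ) ≡ embed φ
sub-embed σ φ = begin
  sub σ (embed φ)           ≡⟨ cong (sub σ) (embed≡sub φ) ⟩
  sub σ (sub (λ ()) φ)      ≡⟨ sub-sub σ (λ ()) φ ⟩
  sub (subT σ ∘ (λ ())) φ   ≡⟨ sub-cong (λ ()) φ ⟩
  sub (λ ()) φ              ≡⟨ embed≡sub φ ⟨
  embed φ                   ∎
  where open ≡-Reasoning

embed-sentence : (φ : Sentence) → embed φ ≡ φ
embed-sentence φ = trans (embed≡sub φ) (trans (sub-cong (λ ()) φ) (sub-var φ))

wk-embed : (φ : Sentence) → wk (embed {n} φ) ≡ embed φ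
wk-embed φ = trans (ren≡sub fs (embed φ)) (sub-embed _ φ)

sub-single-commute : (σ : Fin m → Term n) (t : Term m) (φ : Formula (suc m)) →
                     sub (liftSub σ) φ [ subT σ t ] ≡ sub σ (φ [ t ])
sub-single-commute σ t φ =
  trans (sub-liftSub-single σ (subT σ t) φ) (sym (trans (sub-sub σ (single t) φ) (sub-cong eq φ)))
  where
  eq : subT σ ∘ single t ≗ subT σ t ∷ σ
  eq fz     = refl
  eq (fs i) = refl

sub-liftSub-wk : (σ : Fin m → Term n) (φ : Formula m) → sub (liftSub σ) (wk φ) ≡ wk (sub σ φ)
sub-liftSub-wk σ φ = trans (sub-ren (liftSub σ) fs φ) (sym (ren-sub fs σ φ))

sub-const-var : (φ : Formula 1) → sub (const (var fz)) φ ≡ φ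
sub-const-var φ = trans (sub-cong (λ { fz → refl }) φ) (sub-var φ)

∃' : Formula (suc n) → Formula n
∃' φ = ¬' (∀' (¬' φ))

⊢-mono : (∀ {φ} → T φ → T′ φ) → {ψ : Formula n} → T ⊢ ψ → T′ ⊢ ψ
⊢-mono T⊆T′ (ax x)   = ax (T⊆T′ x)
⊢-mono T⊆T′ A1       = A1
⊢-mono T⊆T′ A2       = A2
⊢-mono T⊆T′ A3       = A3
⊢-mono T⊆T′ Q1       = Q1
⊢-mono T⊆T′ Q2       = Q2
⊢-mono T⊆T′ E1       = E1
⊢-mono T⊆T′ E2       = E2
⊢-mono T⊆T′ (mp d e) = mp (⊢-mono T⊆T′ d) (⊢-mono T⊆T′ e)
⊢-mono T⊆T′ (gen d)  = gen (⊢-mono T⊆T′ d)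

⊢-sub : {φ : Formula m} → T ⊢ φ → (σ : Fin m → Term n) → T ⊢ sub σ φ
⊢-sub (ax {φ = φ} x) σ = subst (_ ⊢_) (sym (sub-embed σ φ)) (ax x)
⊢-sub A1 σ = A1
⊢-sub A2 σ = A2
⊢-sub A3 σ = A3
⊢-sub (Q1 {φ = φ} {t}) σ =
  subst (λ ψ → _ ⊢ ∀' (sub (liftSub σ) φ) ⇒ ψ) (sub-single-commute σ t φ) Q1
⊢-sub (Q2 {ψ = ψ} {φ}) σ =
  subst (λ χ → _ ⊢ ∀' (χ ⇒ sub (liftSub σ) φ) ⇒ sub σ ψ ⇒ ∀' (sub (liftSub σ) φ)) (sym (sub-liftSub-wk σ ψ)) Q2
⊢-sub E1 σ = E1
⊢-sub (E2 {φ = φ} {t} {s}) σ =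
  subst₂ (λ χ χ′ → _ ⊢ subT σ t ≐ subT σ s ⇒ χ ⇒ χ′) (sub-single-commute σ t φ) (sub-single-commute σ s φ) E2
⊢-sub (mp d e) σ = mp (⊢-sub d σ) (⊢-sub e σ)
⊢-sub (gen d)  σ = gen (⊢-sub d (liftSub σ))

⊢-id : {φ : Formula n} → T ⊢ φ ⇒ φ
⊢-id {φ = φ} = mp (mp (A2 {ψ = φ ⇒ φ}) A1) (A1 {ψ = φ})

deduction : {φ : Sentence} {ψ : Formula n} → T ⊕ φ ⊢ ψ → T ⊢ embed φ ⇒ ψ
deduction (ax (inj₁ x))   = mp A1 (ax x)
deduction (ax (inj₂ refl)) = ⊢-id
deduction A1       = mp A1 A1
deduction A2       = mp A1 A2
deduction A3       = mp A1 A3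
deduction Q1       = mp A1 Q1
deduction Q2       = mp A1 Q2
deduction E1       = mp A1 E1
deduction E2       = mp A1 E2
deduction (mp d e) = mp (mp A2 (deduction d)) (deduction e)
deduction {T = T} {φ = φ} (gen d) =
  mp Q2 (gen (subst (λ χ → T ⊢ χ ⇒ _) (sym (wk-embed φ)) (deduction d)))

module NaturalDeduction (T : Theory) where

  infixl 1.5 _▹_
  infix  1 _⊩_

  data Ctx (n : ℕ) : Set where
    ε   : Ctx n
    _▹_ : Ctx n → Formula n → Ctx n

  _⇒*_ : Ctx n → Formula n → Formula n
  ε       ⇒* φ = φ
  (Γ ▹ ψ) ⇒* φ = Γ ⇒* (ψ ⇒ φ)

  -- A record, so that Γ and φ can be inferred from the type Γ ⊩ φ.
  record _⊩_ (Γ : Ctx n) (φ : Formula n) : Set where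
    constructor ⟨_⟩
    field derivation : T ⊢ Γ ⇒* φ
  open _⊩_ public

  private variable
    Γ : Ctx n
    φ ψ χ : Formula n

  close : ε ⊩ φ → T ⊢ φ
  close = derivation

  ⇒I : Γ ▹ φ ⊩ ψ → Γ ⊩ φ ⇒ ψ
  ⇒I ⟨ d ⟩ = ⟨ d ⟩

  ⇒I⁻¹ : Γ ⊩ φ ⇒ ψ → Γ ▹ φ ⊩ ψ
  ⇒I⁻¹ ⟨ d ⟩ = ⟨ d ⟩

  lift : T ⊢ φ → Γ ⊩ φ
  lift {Γ = ε}     d = ⟨ d ⟩
  lift {Γ = Γ ▹ ψ} d = ⇒I⁻¹ (lift (mp A1 d))

  ⇒E : Γ ⊩ φ ⇒ ψ → Γ ⊩ φ → Γ ⊩ ψ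
  ⇒E {Γ = ε}     ⟨ d ⟩ ⟨ e ⟩ = ⟨ mp d e ⟩
  ⇒E {Γ = Γ ▹ χ} d     e     = ⇒I⁻¹ (⇒E (⇒E (lift A2) (⇒I d)) (⇒I e))

  ⇒E′ : T ⊢ φ ⇒ ψ → Γ ⊩ φ → Γ ⊩ ψ
  ⇒E′ d = ⇒E (lift d)

  weaken : Γ ⊩ ψ → Γ ▹ φ ⊩ ψ
  weaken d = ⇒I⁻¹ (⇒E (lift A1) d)

  hyp₀ : Γ ▹ φ ⊩ φ
  hyp₀ = ⇒I⁻¹ (lift ⊢-id)

  hyp₁ : Γ ▹ φ ▹ ψ ⊩ φ
  hyp₁ = weaken hyp₀

  raa : Γ ▹ ¬' φ ⊩ ⊥' → Γ ⊩ φ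
  raa d = ⇒E (lift A3) (⇒I d)

  ⊥E : Γ ⊩ ⊥' → Γ ⊩ φ
  ⊥E d = raa (weaken d)

  ¬E : Γ ⊩ ¬' φ → Γ ⊩ φ → Γ ⊩ ψ
  ¬E d e = ⊥E (⇒E d e)

  ¬¬I : Γ ⊩ φ → Γ ⊩ ¬' (¬' φ)
  ¬¬I d = ⇒I (⇒E hyp₀ (weaken d))

  ∧I : Γ ⊩ φ → Γ ⊩ ψ → Γ ⊩ φ ∧' ψ
  ∧I d e = ⇒I (⇒E (⇒E hyp₀ (weaken d)) (weaken e))

  ∧E₁ : Γ ⊩ φ ∧' ψ → Γ ⊩ φ
  ∧E₁ d = raa (⇒E (weaken d) (⇒I (¬E hyp₁ hyp₀)))

  ∧E₂ : Γ ⊩ φ ∧' ψ → Γ ⊩ ψ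
  ∧E₂ d = raa (⇒E (weaken d) (⇒I (weaken hyp₀)))

  ∨E : Γ ⊩ φ ∨' ψ → Γ ▹ φ ⊩ χ → Γ ▹ ψ ⊩ χ → Γ ⊩ χ
  ∨E {Γ = Γ} {φ = φ} {χ = χ} d e f = raa (⇒E hyp₀ (⇒E (weaken (⇒I f)) (⇒E (weaken d) ¬φ)))
    where
    ¬φ : Γ ▹ ¬' χ ⊩ ¬' φ
    ¬φ = ⇒I (⇒E hyp₁ (⇒E (weaken (weaken (⇒I e))) hyp₀))

  ⇔-refuted : Γ ⊩ ¬' φ → Γ ⊩ ¬' ψ → Γ ⊩ φ ⇔ ψ
  ⇔-refuted ¬φ ¬ψ = ∧I (⇒I (¬E (weaken ¬φ) hyp₀)) (⇒I (¬E (weaken ¬ψ) hyp₀))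

  ∀E : (t : Term n) → Γ ⊩ ∀' φ → Γ ⊩ φ [ t ]
  ∀E t = ⇒E′ Q1

  ∃I : (t : Term n) → Γ ⊩ φ [ t ] → Γ ⊩ ∃' φ
  ∃I t d = ⇒I (⇒E (∀E t hyp₀) (weaken d))

  ∀I : ε ▹ wk ψ ⊩ φ → ε ▹ ψ ⊩ ∀' φ
  ∀I ⟨ d ⟩ = ⟨ mp Q2 (gen d) ⟩

  ∃E : ε ▹ φ ⊩ wk ψ → ε ▹ ∃' φ ⊩ ψ
  ∃E {φ = φ} {ψ = ψ} d = raa (⇒E hyp₁ (⇒E′ (close ¬ψ⇒∀¬φ) hyp₀))
    where
    ¬ψ⇒∀¬φ : ε ⊩ ¬' ψ ⇒ ∀' (¬' φ)
    ¬ψ⇒∀¬φ = ⇒I (∀I (⇒I (⇒E hyp₁ (⇒E (weaken (weaken (⇒I d))) hyp₀))))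

-- Equality and Robinson's theory R

eval : Term n → (Fin n → ℕ) → ℕ
eval (var i)  ν = ν i
eval zero'    ν = 0
eval (suc' t) ν = suc (eval t ν)
eval (t +' s) ν = eval t ν + eval s ν
eval (t *' s) ν = eval t ν * eval s ν

eval-num : (k : ℕ) (ν : Fin n → ℕ) → eval (num k) ν ≡ k
eval-num zero    ν = refl
eval-num (suc k) ν = cong suc (eval-num k ν)

eval-wk : (t : Term n) (i : ℕ) (ν : Fin n → ℕ) → eval (renT fs t) (i ∷ ν) ≡ eval t ν
eval-wk (var j)  i ν = refl
eval-wk zero'    i ν = refl
eval-wk (suc' t) i ν = cong suc (eval-wk t i ν)
eval-wk (t +' s) i ν = cong₂ _+_ (eval-wk t i ν) (eval-wk s i ν)
eval-wk (t *' s) i ν = cong₂ _*_ (eval-wk t i ν) (eval-wk s i ν)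

module Equality (T : Theory) where

  open NaturalDeduction T

  private variable
    Γ : Ctx n
    t t′ s s′ : Term n

  ≐-refl : Γ ⊩ t ≐ t
  ≐-refl = lift E1

  ≐-subst : (φ : Formula (suc n)) {A B : Formula n} →
            φ [ t ] ≡ A → φ [ s ] ≡ B → Γ ⊩ t ≐ s → Γ ⊩ A → Γ ⊩ B
  ≐-subst φ refl refl = ⇒E ∘ ⇒E′ (E2 {φ = φ})

  ≐-subst-const : (φ : Formula 1) → Γ ⊩ t ≐ s → Γ ⊩ sub (const t) φ → Γ ⊩ sub (const s) φ
  ≐-subst-const φ = ≐-subst (ren (const fz) φ) (sub-ren _ _ φ) (sub-ren _ _ φ)

  ≐-sym : Γ ⊩ t ≐ s → Γ ⊩ s ≐ t
  ≐-sym {t = t} {s = s} d =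
    ≐-subst (var fz ≐ renT fs t) (cong (t ≐_) (subT-single-wk t t)) (cong (s ≐_) (subT-single-wk s t)) d ≐-refl

  ≐-trans : Γ ⊩ t ≐ s → Γ ⊩ s ≐ s′ → Γ ⊩ t ≐ s′
  ≐-trans {t = t} {s = s} {s′ = s′} d e =
    ≐-subst (renT fs t ≐ var fz) (cong (_≐ s) (subT-single-wk s t)) (cong (_≐ s′) (subT-single-wk s′ t)) e d

  ≐-cong : (u : Term (suc n)) → Γ ⊩ t ≐ s → Γ ⊩ subT (single t) u ≐ subT (single s) u
  ≐-cong {t = t} {s = s} u d =
    ≐-subst (renT fs tu ≐ u) (cong (_≐ tu) (subT-single-wk t tu)) (cong (_≐ _) (subT-single-wk s tu)) d ≐-refl
    where tu = subT (single t) u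

  suc'-cong : Γ ⊩ t ≐ s → Γ ⊩ suc' t ≐ suc' s
  suc'-cong = ≐-cong (suc' (var fz))

  +'-cong : Γ ⊩ t ≐ t′ → Γ ⊩ s ≐ s′ → Γ ⊩ t +' s ≐ t′ +' s′
  +'-cong {Γ = Γ} {t = t} {t′ = t′} {s = s} {s′ = s′} d e = ≐-trans
    (subst₂ (λ a b → Γ ⊩ t +' a ≐ t′ +' b) (subT-single-wk t s) (subT-single-wk t′ s)
      (≐-cong (var fz +' renT fs s) d))
    (subst₂ (λ a b → Γ ⊩ a +' s ≐ b +' s′) (subT-single-wk s t′) (subT-single-wk s′ t′)
      (≐-cong (renT fs t′ +' var fz) e))

  *'-cong : Γ ⊩ t ≐ t′ → Γ ⊩ s ≐ s′ → Γ ⊩ t *' s ≐ t′ *' s′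
  *'-cong {Γ = Γ} {t = t} {t′ = t′} {s = s} {s′ = s′} d e = ≐-trans
    (subst₂ (λ a b → Γ ⊩ t *' a ≐ t′ *' b) (subT-single-wk t s) (subT-single-wk t′ s)
      (≐-cong (var fz *' renT fs s) d))
    (subst₂ (λ a b → Γ ⊩ a *' s ≐ b *' s′) (subT-single-wk s t′) (subT-single-wk s′ t′)
      (≐-cong (renT fs t′ *' var fz) e))

  ≤'-resp-≐ : Γ ⊩ t ≐ t′ → Γ ⊩ s ≐ s′ → Γ ⊩ t ≤' s → Γ ⊩ t′ ≤' s′
  ≤'-resp-≐ {t = t} {t′ = t′} {s = s} {s′ = s′} d e =
    ≐-subst (renT fs t′ ≤' var fz) (cong (_≤' s) (subT-single-wk s t′)) (cong (_≤' s′) (subT-single-wk s′ t′)) e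
    ∘ ≐-subst (var fz ≤' renT fs s) (cong (t ≤'_) (subT-single-wk t s)) (cong (t′ ≤'_) (subT-single-wk t′ s)) d

all≤⊎∃≤ : {P Q : ℕ → Set} (k : ℕ) → (∀ i → i ≤ k → P i ⊎ Q i) →
          (∀ i → i ≤ k → P i) ⊎ ∃[ i ] i ≤ k × Q i
all≤⊎∃≤ zero h with h 0 z≤n
... | inj₁ p = inj₁ λ { .0 z≤n → p }
... | inj₂ q = inj₂ (0 , z≤n , q)
all≤⊎∃≤ (suc k) h with all≤⊎∃≤ k (λ i le → h i (m≤n⇒m≤1+n le)) | h (suc k) ≤-refl
... | inj₂ (i , le , q) | _     = inj₂ (i , m≤n⇒m≤1+n le , q)
... | inj₁ _            | inj₂ q = inj₂ (suc k , ≤-refl , q)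
... | inj₁ ps           | inj₁ p = inj₁ λ i le → case m≤n⇒m<n∨m≡n le of λ where
  (inj₁ lt)   → ps i (m<1+n⇒m≤n lt)
  (inj₂ refl) → p

module Robinson (T : Theory) (R⊆T : Extends T R) where

  open NaturalDeduction T
  open Equality T

  private variable
    i k : ℕ
    Γ : Ctx n
    Γ₀ : Ctx 0

  axiom : {φ : Sentence} → R φ → Γ₀ ⊩ φ
  axiom r = lift (R⊆T _ r)

  axiom-instance : {φ : Formula 1} → R (∀' φ) → (t : Term n) → Γ ⊩ sub (t ∷ []) φ
  axiom-instance {φ = φ} r t =
    lift (subst (T ⊢_) (sub-liftSub-single [] t φ) (close (∀E t (lift (⊢-sub (R⊆T _ r) [])))))

  eval-correct : (t : Term n) (ν : Fin n → ℕ) → Γ₀ ⊩ subT (num ∘ ν) t ≐ num (eval t ν)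
  eval-correct (var i)  ν = ≐-refl
  eval-correct zero'    ν = ≐-refl
  eval-correct (suc' t) ν = suc'-cong (eval-correct t ν)
  eval-correct (t +' s) ν = ≐-trans (+'-cong (eval-correct t ν) (eval-correct s ν)) (axiom (Ω1 _ _))
  eval-correct (t *' s) ν = ≐-trans (*'-cong (eval-correct t ν) (eval-correct s ν)) (axiom (Ω2 _ _))

  ≤'-total : (t : Term n) (k : ℕ) → Γ ⊩ t ≤' num k ∨' num k ≤' t
  ≤'-total t k = subst (λ a → _ ⊩ t ≤' a ∨' a ≤' t) (subT-num _ k) (axiom-instance (Ω5 k) t)

  upto-refute : k < i → Γ₀ ⊩ ¬' (upto k [ num i ])
  upto-refute {k = zero}  k<i = axiom (Ω3 _ _ λ e → <-irrefl (sym e) k<i)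
  upto-refute {k = suc k} {i = i} {Γ₀ = Γ} k<i = ⇒I (⇒E i≢1+k (⇒E hyp₀ (upto-refute (≤-trans (n≤1+n _) k<i))))
    where
    Γ′ = Γ ▹ upto (suc k) [ num i ]
    i≢1+k : Γ′ ⊩ ¬' (num i ≐ subT (single (num i)) (num (suc k)))
    i≢1+k = subst (λ a → Γ′ ⊩ ¬' (num i ≐ a)) (sym (subT-num _ (suc k)))
                  (axiom (Ω3 _ _ λ e → <-irrefl (sym e) k<i))

  num-≰ : k < i → Γ₀ ⊩ ¬' (num i ≤' num k)
  num-≰ {k = k} {i = i} {Γ₀ = Γ} k<i = ⇒I (⇒E (upto-refute k<i) (⇒E Ω4-at-i hyp₀))
    where
    Γ′ = Γ ▹ num i ≤' num k
    Ω4-at-i : Γ′ ⊩ num i ≤' num k ⇒ upto k [ num i ]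
    Ω4-at-i = subst (λ a → Γ′ ⊩ num i ≤' a ⇒ upto k [ num i ]) (subT-num _ k) (∀E (num i) (axiom (Ω4 k)))

  num-≤ : i ≤ k → Γ₀ ⊩ num i ≤' num k
  num-≤ {i = i} {k = k} i≤k with i ≟ k
  ... | yes refl = ∨E (≤'-total (num k) k) hyp₀ hyp₀
  ... | no i≢k   = ∨E (≤'-total (num i) k) hyp₀ (¬E (num-≰ (≤∧≢⇒< i≤k i≢k)) hyp₀)

  =-elim : (φ : Formula 1) → T ⊢ φ [ num i ] → T ⊢ var fz ≐ num i ⇒ φ
  =-elim {i = i} φ d = close (⇒I (subst (_ ⊩_) (sub-const-var φ) (≐-subst-const φ (≐-sym hyp₀) (lift at-num))))
    where
    at-num : T ⊢ sub (const (num {1} i)) φ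
    at-num = subst (T ⊢_) (trans (sub-sub [] (single (num i)) φ) (sub-cong (λ { fz → subT-num [] i }) φ))
                   (⊢-sub d [])

  upto-elim : (φ : Formula 1) → (∀ i → i ≤ k → T ⊢ φ [ num i ]) → T ⊢ upto k ⇒ φ
  upto-elim {k = zero}  φ h = =-elim φ (h 0 z≤n)
  upto-elim {k = suc k} φ h = close (⇒I (∨E hyp₀
    (⇒E′ (upto-elim φ (λ i le → h i (m≤n⇒m≤1+n le))) hyp₀)
    (⇒E′ (=-elim φ (h (suc k) ≤-refl)) hyp₀)))

  bounded-∀I : (φ : Formula 1) → (∀ i → i ≤ k → T ⊢ φ [ num i ]) → T ⊢ ∀' (var fz ≤' num k ⇒ φ)
  bounded-∀I {k = k} φ h = gen (close (⇒I (⇒E′ (upto-elim φ h) (⇒E Ω4-at-var hyp₀))))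
    where
    Ω4-at-var : ε ▹ var fz ≤' num k ⊩ var fz ≤' num k ⇒ upto k
    Ω4-at-var = subst (ε ▹ var fz ≤' num k ⊩_) (trans (sub-cong (λ { fz → refl }) body) (sub-var body))
                  (axiom-instance (Ω4 k) (var fz))
      where body = x₀ ≤' num k ⇒ upto k

  bounded-∀E : {φ : Formula 1} → Γ₀ ⊩ ∀' (var fz ≤' num k ⇒ φ) → i ≤ k → Γ₀ ⊩ φ [ num i ]
  bounded-∀E {Γ₀ = Γ} {k = k} {i = i} {φ = φ} d i≤k =
    ⇒E (subst (λ a → Γ ⊩ num i ≤' a ⇒ φ [ num i ]) (subT-num _ k) (∀E (num i) d)) (num-≤ i≤k)

-- Bounded formulas

infix  4 _≐₀_ _≤₀_
infix  1 _⊨_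
infixr 3 _∧₀_
infixr 2 _⇒₀_

data Δ₀ : ℕ → Set where
  _≐₀_ _≤₀_ : Term n → Term n → Δ₀ n
  ⊥₀        : Δ₀ n
  _⇒₀_ _∧₀_ : Δ₀ n → Δ₀ n → Δ₀ n
  ∀≤ ∃≤     : Fin n → Δ₀ (suc n) → Δ₀ n
  rename₀   : (Fin m → Fin n) → Δ₀ m → Δ₀ n

⌊_⌋ : Δ₀ n → Formula n
⌊ t ≐₀ s ⌋      = t ≐ s
⌊ t ≤₀ s ⌋      = t ≤' s
⌊ ⊥₀ ⌋          = ⊥'
⌊ φ ⇒₀ ψ ⌋      = ⌊ φ ⌋ ⇒ ⌊ ψ ⌋
⌊ φ ∧₀ ψ ⌋      = ⌊ φ ⌋ ∧' ⌊ ψ ⌋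
⌊ ∀≤ b φ ⌋      = ∀' (var fz ≤' var (fs b) ⇒ ⌊ φ ⌋)
⌊ ∃≤ b φ ⌋      = ¬' (∀' (var fz ≤' var (fs b) ⇒ ¬' ⌊ φ ⌋))
⌊ rename₀ ρ φ ⌋ = ren ρ ⌊ φ ⌋

_⊨_ : (Fin n → ℕ) → Δ₀ n → Set
ν ⊨ t ≐₀ s      = eval t ν ≡ eval s ν
ν ⊨ t ≤₀ s      = eval t ν ≤ eval s ν
ν ⊨ ⊥₀          = ⊥
ν ⊨ φ ⇒₀ ψ      = ν ⊨ φ → ν ⊨ ψ
ν ⊨ φ ∧₀ ψ      = (ν ⊨ φ) × (ν ⊨ ψ)
ν ⊨ ∀≤ b φ      = ∀ i → i ≤ ν b → i ∷ ν ⊨ φ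
ν ⊨ ∃≤ b φ      = ∃[ i ] i ≤ ν b × (i ∷ ν ⊨ φ)
ν ⊨ rename₀ ρ φ = ν ∘ ρ ⊨ φ

¬₀ : Δ₀ n → Δ₀ n
¬₀ φ = φ ⇒₀ ⊥₀

module Δ₀-Completeness (T : Theory) (R⊆T : Extends T R) where

  open NaturalDeduction T
  open Equality T
  open Robinson T R⊆T

  private variable
    P Q : Set
    φ ψ : Sentence

  Decides : Set → Sentence → Set
  Decides P φ = (P × (T ⊢ φ)) ⊎ (¬ P × (T ⊢ ¬' φ))

  decides-≐ : (t s : Term n) (ν : Fin n → ℕ) →
              Decides (eval t ν ≡ eval s ν) (subT (num ∘ ν) t ≐ subT (num ∘ ν) s)
  decides-≐ t s ν with eval t ν ≟ eval s ν
  ... | yes t≡s = inj₁ (t≡s , close (≐-trans (eval-correct t ν)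
                          (subst (λ k → ε ⊩ num k ≐ _) (sym t≡s) (≐-sym (eval-correct s ν)))))
  ... | no t≢s  = inj₂ (t≢s , close (⇒I (⇒E (axiom (Ω3 _ _ t≢s))
                          (≐-trans (≐-sym (eval-correct t ν)) (≐-trans hyp₀ (eval-correct s ν))))))

  decides-≤ : (t s : Term n) (ν : Fin n → ℕ) →
              Decides (eval t ν ≤ eval s ν) (subT (num ∘ ν) t ≤' subT (num ∘ ν) s)
  decides-≤ t s ν with eval t ν ≤? eval s ν
  ... | yes t≤s = inj₁ (t≤s , close (≤'-resp-≐ (≐-sym (eval-correct t ν)) (≐-sym (eval-correct s ν))
                                                (num-≤ t≤s)))
  ... | no t≰s  = inj₂ (t≰s , close (⇒I (⇒E (num-≰ (≰⇒> t≰s))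
                          (≤'-resp-≐ (eval-correct t ν) (eval-correct s ν) hyp₀))))

  decides-⊥ : Decides ⊥ ⊥'
  decides-⊥ = inj₂ (id , ⊢-id)

  decides-⇒ : Decides P φ → Decides Q ψ → Decides (P → Q) (φ ⇒ ψ)
  decides-⇒ (inj₂ (¬p , ⊢¬φ)) _             = inj₁ ((λ p → ⊥-elim (¬p p)) , close (⇒I (¬E (lift ⊢¬φ) hyp₀)))
  decides-⇒ (inj₁ _) (inj₁ (q , ⊢ψ))        = inj₁ ((λ _ → q) , close (⇒I (lift ⊢ψ)))
  decides-⇒ (inj₁ (p , ⊢φ)) (inj₂ (¬q , ⊢¬ψ)) =
    inj₂ ((λ f → ¬q (f p)) , close (⇒I (⇒E (lift ⊢¬ψ) (⇒E hyp₀ (lift ⊢φ)))))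

  decides-∧ : Decides P φ → Decides Q ψ → Decides (P × Q) (φ ∧' ψ)
  decides-∧ (inj₂ (¬p , ⊢¬φ)) _              = inj₂ ((¬p ∘ proj₁) , close (⇒I (⇒E (lift ⊢¬φ) (∧E₁ hyp₀))))
  decides-∧ (inj₁ _) (inj₂ (¬q , ⊢¬ψ))        = inj₂ ((¬q ∘ proj₂) , close (⇒I (⇒E (lift ⊢¬ψ) (∧E₂ hyp₀))))
  decides-∧ (inj₁ (p , ⊢φ)) (inj₁ (q , ⊢ψ))   = inj₁ ((p , q) , close (∧I (lift ⊢φ) (lift ⊢ψ)))

  decides-∀≤ : {P : ℕ → Set} (φ : Formula 1) (k : ℕ) → (∀ i → i ≤ k → Decides (P i) (φ [ num i ])) →
               Decides (∀ i → i ≤ k → P i) (∀' (var fz ≤' num k ⇒ φ))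
  decides-∀≤ φ k h with all≤⊎∃≤ k h
  ... | inj₁ all = inj₁ ((λ i i≤k → proj₁ (all i i≤k)) , bounded-∀I φ (λ i i≤k → proj₂ (all i i≤k)))
  ... | inj₂ (i , i≤k , ¬p , ⊢¬φ) =
    inj₂ ((λ all → ¬p (all i i≤k)) , close (⇒I (⇒E (lift ⊢¬φ) (bounded-∀E hyp₀ i≤k))))

  decides-∃≤ : {P : ℕ → Set} (φ : Formula 1) (k : ℕ) → (∀ i → i ≤ k → Decides (P i) (φ [ num i ])) →
               Decides (∃[ i ] i ≤ k × P i) (¬' (∀' (var fz ≤' num k ⇒ ¬' φ)))
  decides-∃≤ φ k h with all≤⊎∃≤ k (λ i i≤k → swap (h i i≤k))
  ... | inj₁ none = inj₂ ((λ (i , i≤k , p) → proj₁ (none i i≤k) p) ,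
                          close (¬¬I (lift (bounded-∀I (¬' φ) (λ i i≤k → proj₂ (none i i≤k))))))
  ... | inj₂ (i , i≤k , p , ⊢φ) =
    inj₁ ((i , i≤k , p) , close (⇒I (⇒E (bounded-∀E hyp₀ i≤k) (lift ⊢φ))))

  private
    instantiate : (ν : Fin n → ℕ) (i : ℕ) (φ : Formula (suc n)) →
                  _≡_ {A = Sentence} (sub (liftSub (num ∘ ν)) φ [ num i ]) (sub (num ∘ (i ∷ ν)) φ)
    instantiate ν i φ = trans (sub-liftSub-single _ _ φ) (sub-cong (λ { fz → refl ; (fs j) → refl }) φ)

    bound : (k : ℕ) (φ : Formula 1) → ∀' (var fz ≤' num k ⇒ φ) ≡ ∀' (var fz ≤' renT fs (num k) ⇒ φ)
    bound k φ = cong (λ t → ∀' (var fz ≤' t ⇒ φ)) (sym (renT-num fs k))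

  decide : (φ : Δ₀ n) (ν : Fin n → ℕ) → Decides (ν ⊨ φ) (sub (num ∘ ν) ⌊ φ ⌋)
  decide (t ≐₀ s) ν = decides-≐ t s ν
  decide (t ≤₀ s) ν = decides-≤ t s ν
  decide ⊥₀       ν = decides-⊥
  decide (φ ⇒₀ ψ) ν = decides-⇒ (decide φ ν) (decide ψ ν)
  decide (φ ∧₀ ψ) ν = decides-∧ (decide φ ν) (decide ψ ν)
  decide (∀≤ b φ) ν = subst (Decides _) (bound (ν b) _)
    (decides-∀≤ _ (ν b) λ i _ → subst (Decides _) (sym (instantiate ν i ⌊ φ ⌋)) (decide φ (i ∷ ν)))
  decide (∃≤ b φ) ν = subst (Decides _) (cong ¬' (bound (ν b) _))
    (decides-∃≤ _ (ν b) λ i _ → subst (Decides _) (sym (instantiate ν i ⌊ φ ⌋)) (decide φ (i ∷ ν)))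
  decide (rename₀ ρ φ) ν = subst (Decides _) (sym (sub-ren (num ∘ ν) ρ ⌊ φ ⌋)) (decide φ (ν ∘ ρ))

  private
    Δ₀-complete-closed : (φ : Δ₀ n) (ν : Fin n → ℕ) → ν ⊨ φ → T ⊢ sub (num ∘ ν) ⌊ φ ⌋
    Δ₀-complete-closed φ ν holds with decide φ ν
    ... | inj₁ (_ , ⊢φ)  = ⊢φ
    ... | inj₂ (¬φ , _) = ⊥-elim (¬φ holds)

  Δ₀-complete : {Γ : Ctx m} (φ : Δ₀ n) (ν : Fin n → ℕ) → ν ⊨ φ → Γ ⊩ sub (num ∘ ν) ⌊ φ ⌋
  Δ₀-complete φ ν holds = lift (subst (T ⊢_) closed-instance (⊢-sub (Δ₀-complete-closed φ ν holds) []))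
    where
    closed-instance : sub [] (sub (num ∘ ν) ⌊ φ ⌋) ≡ sub (num ∘ ν) ⌊ φ ⌋
    closed-instance = trans (sub-sub [] (num ∘ ν) ⌊ φ ⌋) (sub-cong (λ i → subT-num [] (ν i)) ⌊ φ ⌋)

  ∀≤-elim : {Γ : Ctx m} (σ : Fin n → Term m) (b : Fin n) (φ : Δ₀ (suc n)) (t : Term m) →
            Γ ⊩ sub σ ⌊ ∀≤ b φ ⌋ → Γ ⊩ t ≤' σ b → Γ ⊩ sub (t ∷ σ) ⌊ φ ⌋
  ∀≤-elim {Γ = Γ} σ b φ t d = ⇒E (subst (Γ ⊩_) instance-eq (∀E t d))
    where
    instance-eq : (var fz ≤' renT fs (σ b) ⇒ sub (liftSub σ) ⌊ φ ⌋) [ t ] ≡ (t ≤' σ b ⇒ sub (t ∷ σ) ⌊ φ ⌋)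
    instance-eq = cong₂ (λ a ψ → t ≤' a ⇒ ψ) (subT-single-wk t (σ b)) (sub-liftSub-single σ t ⌊ φ ⌋)

-- Cantor pairing and Gödel's β-function

tri-double : ∀ s → 2 * tri s ≡ s * suc s
tri-double zero    = refl
tri-double (suc s) = begin
  2 * (suc s + tri s)    ≡⟨ *-distribˡ-+ 2 (suc s) (tri s) ⟩
  2 * suc s + 2 * tri s  ≡⟨ cong (2 * suc s +_) (tri-double s) ⟩
  2 * suc s + s * suc s  ≡⟨ regroup s ⟩
  suc s * suc (suc s)    ∎
  where
  open ≡-Reasoning
  regroup : ∀ s → 2 * suc s + s * suc s ≡ suc s * suc (suc s)
  regroup = solve-∀

pair-double : ∀ a b → 2 * pair a b ≡ (a + b) * suc (a + b) + 2 * b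
pair-double a b = trans (*-distribˡ-+ 2 (tri (a + b)) b) (cong (_+ 2 * b) (tri-double (a + b)))

pair-unique : ∀ {a b z} → 2 * z ≡ (a + b) * suc (a + b) + 2 * b → z ≡ pair a b
pair-unique {a} {b} {z} eq = *-cancelˡ-≡ z (pair a b) 2 (trans eq (sym (pair-double a b)))

n≤tri : ∀ n → n ≤ tri n
n≤tri zero    = z≤n
n≤tri (suc n) = m≤m+n (suc n) (tri n)

m≤pair : ∀ m n → m ≤ pair m n
m≤pair m n = ≤-trans (m≤m+n m n) (≤-trans (n≤tri (m + n)) (m≤m+n _ n))

n≤pair : ∀ m n → n ≤ pair m n
n≤pair m n = m≤n+m n _

β-modulus : ℕ → ℕ → ℕ
β-modulus q i = suc (suc i * q)

β : ℕ → ℕ → ℕ → ℕ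
β p q i = p % β-modulus q i

%-unique : ∀ {p r} k n .{{_ : NonZero n}} → p ≡ r + k * n → r < n → p % n ≡ r
%-unique {p} {r} k n p≡r+kn r<n = begin
  p % n            ≡⟨ cong (_% n) p≡r+kn ⟩
  (r + k * n) % n  ≡⟨ [m+kn]%n≡m%n r k n ⟩
  r % n            ≡⟨ m<n⇒m%n≡m r<n ⟩
  r                ∎
  where open ≡-Reasoning

-- Bézout gives x with x M ≡ ±1 (mod m); then t = x c works for a suitable c ≡ ±(s − a) (mod m).
crt-step : ∀ a M m s .{{_ : NonZero m}} → Coprime M m → s < m → ∃[ t ] (a + t * M) % m ≡ s
crt-step a M m@(suc m′) s M⊥m s<m with coprime-Bézout M⊥m
... | Bézout.+- x y 1+ym≡xM = x * c , %-unique (a + y * c) m reduce s<m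
  where
  open ≡-Reasoning
  c = s + m′ * a
  reduce : a + x * c * M ≡ s + (a + y * c) * m
  reduce = begin
    a + x * c * M        ≡⟨ cong (a +_) (reassoc x c M) ⟩
    a + c * (x * M)      ≡⟨ cong (λ z → a + c * z) 1+ym≡xM ⟨
    a + c * (1 + y * m)  ≡⟨ collect a s m′ y ⟩
    s + (a + y * c) * m  ∎
    where
    reassoc : ∀ x c M → x * c * M ≡ c * (x * M)
    reassoc = solve-∀
    collect : ∀ a s m′ y → a + (s + m′ * a) * (1 + y * suc m′) ≡ s + (a + y * (s + m′ * a)) * suc m′
    collect = solve-∀
... | Bézout.-+ x y 1+xM≡ym = x * c , (begin
    v % m              ≡⟨ [m+kn]%n≡m%n v s m ⟨
    (v + s * m) % m    ≡⟨ %-unique (y * c) m reduce s<m ⟩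
    s                  ∎)
  where
  open ≡-Reasoning
  c = a + m′ * s
  v = a + x * c * M
  reduce : v + s * m ≡ s + y * c * m
  reduce = +-cancelʳ-≡ c _ _ (begin
    v + s * m + c                  ≡⟨ expand a x c M m′ s ⟩
    c + s + c * (1 + x * M)        ≡⟨ cong (λ z → c + s + c * z) 1+xM≡ym ⟩
    c + s + c * (y * m)            ≡⟨ collect c s y m ⟩
    s + y * c * m + c              ∎)
    where
    expand : ∀ a x c M m′ s → a + x * c * M + s * suc m′ + c ≡ (a + m′ * s) + s + c * (1 + x * M)
    expand = solve-∀
    collect : ∀ c s y m → c + s + c * (y * m) ≡ s + y * c * m + c
    collect = solve-∀

coprime-*ˡ : ∀ {a b m} → Coprime a m → Coprime b m → Coprime (a * b) m
coprime-*ˡ a⊥m b⊥m {d} (d∣ab , d∣m) = b⊥m (coprime-divisor d⊥a d∣ab , d∣m)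
  where
  d⊥a : Coprime d _
  d⊥a (x∣d , x∣a) = a⊥m (x∣a , ∣-trans x∣d d∣m)

private
  ∣suc∧∣⇒≡1 : ∀ {d x} → d ∣ suc x → d ∣ x → d ≡ 1
  ∣suc∧∣⇒≡1 {d} {x} d∣1+x d∣x = ∣1⇒≡1 (∣m+n∣m⇒∣n (subst (d ∣_) (+-comm 1 x) d∣1+x) d∣x)

-- A common divisor d of the two moduli divides their difference (1 + e) q and is coprime to q,
-- so d ∣ 1 + e ∣ q; as d also divides 1 + (1 + i) q, d = 1.
β-moduli-coprime : ∀ q i e → suc e ∣ q → Coprime (β-modulus q i) (β-modulus q (i + suc e))
β-moduli-coprime q i e 1+e∣q {d} (d∣mᵢ , d∣mⱼ) = ∣suc∧∣⇒≡1 d∣mᵢ (∣n⇒∣m*n (suc i) (∣-trans d∣1+e 1+e∣q))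
  where
  difference : β-modulus q (i + suc e) ≡ β-modulus q i + suc e * q
  difference = cong suc (split i e q)
    where
    split : ∀ i e q → suc (i + suc e) * q ≡ suc i * q + suc e * q
    split = solve-∀
  d⊥q : Coprime d q
  d⊥q (x∣d , x∣q) = ∣suc∧∣⇒≡1 (∣-trans x∣d d∣mᵢ) (∣n⇒∣m*n (suc i) x∣q)
  d∣1+e : d ∣ suc e
  d∣1+e = coprime-divisor d⊥q (subst (d ∣_) (*-comm (suc e) q) (∣m+n∣m⇒∣n (subst (d ∣_) difference d∣mⱼ) d∣mᵢ))

n≤n! : ∀ n → n ≤ n !
n≤n! zero    = z≤n
n≤n! (suc n) = ∣⇒≤ {{(suc n) !≢0}} (m∣m*n (n !))

sum≤ : (ℕ → ℕ) → ℕ → ℕ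
sum≤ s zero    = s 0
sum≤ s (suc k) = sum≤ s k + s (suc k)

≤-sum≤ : ∀ s {i} k → i ≤ k → s i ≤ sum≤ s k
≤-sum≤ s zero    z≤n = ≤-refl
≤-sum≤ s (suc k) i≤1+k with m≤n⇒m<n∨m≡n i≤1+k
... | inj₁ i<1+k = ≤-trans (≤-sum≤ s k (m<1+n⇒m≤n i<1+k)) (m≤m+n _ _)
... | inj₂ refl  = m≤n+m _ _

-- Gödel's choice q = L! with L ≥ k, s 0 , … , s k makes the moduli 1 + (1 + i) q (i ≤ k) pairwise
-- coprime and larger than every s i; the Chinese remainder theorem then provides p.
module β-Construction (s : ℕ → ℕ) (k : ℕ) where

  q : ℕ
  q = (k + sum≤ s k) !

  s<modulus : ∀ {i} → i ≤ k → s i < β-modulus q i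
  s<modulus {i} i≤k = s≤s (begin
    s i             ≤⟨ ≤-sum≤ s k i≤k ⟩
    sum≤ s k        ≤⟨ m≤n+m _ k ⟩
    k + sum≤ s k    ≤⟨ n≤n! _ ⟩
    q               ≤⟨ m≤n*m q (suc i) ⟩
    suc i * q       ∎)
    where open ≤-Reasoning

  moduli-coprime : ∀ {i j} → i < j → j ≤ k → Coprime (β-modulus q i) (β-modulus q j)
  moduli-coprime {i} {j} i<j j≤k =
    subst (λ j → Coprime (β-modulus q i) (β-modulus q j)) i+[j-i]≡j (β-moduli-coprime q i e 1+e∣q)
    where
    e = j ∸ suc i
    i+[j-i]≡j : i + suc e ≡ j
    i+[j-i]≡j = trans (+-suc i e) (m+[n∸m]≡n i<j)
    1+e≤L : suc e ≤ k + sum≤ s k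
    1+e≤L = ≤-trans (subst (suc e ≤_) i+[j-i]≡j (m≤n+m (suc e) i)) (≤-trans j≤k (m≤m+n k _))
    1+e∣q : suc e ∣ q
    1+e∣q = ∣-trans (m∣m*n (e !)) (m≤n⇒m!∣n! 1+e≤L)

  product : ℕ → ℕ
  product zero    = β-modulus q 0
  product (suc K) = product K * β-modulus q (suc K)

  modulus∣product : ∀ {i} K → i ≤ K → β-modulus q i ∣ product K
  modulus∣product zero    z≤n = ∣-refl
  modulus∣product (suc K) i≤1+K with m≤n⇒m<n∨m≡n i≤1+K
  ... | inj₁ i<1+K = ∣m⇒∣m*n _ (modulus∣product K (m<1+n⇒m≤n i<1+K))
  ... | inj₂ refl  = n∣m*n (product K)

  product-coprime : ∀ K {j} → K < j → j ≤ k → Coprime (product K) (β-modulus q j)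
  product-coprime zero    0<j     j≤k = moduli-coprime 0<j j≤k
  product-coprime (suc K) 1+K<j   j≤k =
    coprime-*ˡ (product-coprime K (≤-trans (n≤1+n _) 1+K<j) j≤k) (moduli-coprime 1+K<j j≤k)

  chinese-remainder : ∀ K → K ≤ k → ∃[ p ] ∀ i → i ≤ K → β p q i ≡ s i
  chinese-remainder zero    _     = s 0 , λ { .0 z≤n → m<n⇒m%n≡m (s<modulus z≤n) }
  chinese-remainder (suc K) 1+K≤k with chinese-remainder K (≤-trans (n≤1+n K) 1+K≤k)
  ... | p , p-fits with crt-step p (product K) (β-modulus q (suc K)) (s (suc K))
                          (product-coprime K ≤-refl 1+K≤k) (s<modulus 1+K≤k)
  ... | t , t-fits = p + t * product K , fits
    where
    fits : ∀ i → i ≤ suc K → β (p + t * product K) q i ≡ s i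
    fits i i≤1+K with m≤n⇒m<n∨m≡n i≤1+K
    ... | inj₁ i<1+K =
      trans (%-remove-+ʳ p (∣n⇒∣m*n t (modulus∣product K (m<1+n⇒m≤n i<1+K)))) (p-fits i (m<1+n⇒m≤n i<1+K))
    ... | inj₂ refl  = t-fits

β-lemma : (s : ℕ → ℕ) (k : ℕ) → ∃[ p ] ∃[ q ] ∀ i → i ≤ k → β p q i ≡ s i
β-lemma s k with β-Construction.chinese-remainder s k k ≤-refl
... | p , p-fits = p , β-Construction.q s k , p-fits

-- Opaque, so that the typechecker never unfolds the Cantor pairing inside Gödel numbers.
opaque
  pairᵒ : ℕ → ℕ → ℕ
  pairᵒ = pair

opaque
  unfolding pairᵒ

  pairᵒ≡pair : ∀ a b → pairᵒ a b ≡ pair a b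
  pairᵒ≡pair a b = refl

  code-⇒ : (φ ψ : Formula n) → code (φ ⇒ ψ) ≡ pairᵒ 8 (pairᵒ (code φ) (code ψ))
  code-⇒ φ ψ = refl

  code-∀ : (φ : Formula (suc n)) → code (∀' φ) ≡ pairᵒ 9 (code φ)
  code-∀ φ = refl

  code-⊥ : code (⊥' {n}) ≡ pairᵒ 7 0
  code-⊥ = refl

  code-≐ : (t s : Term n) → code (t ≐ s) ≡ pairᵒ 5 (pairᵒ (codeT t) (codeT s))
  code-≐ t s = refl

data PairExpr (m : ℕ) : Set where
  pvar   : Fin m → PairExpr m
  pconst : ℕ → PairExpr m
  ppair  : PairExpr m → PairExpr m → PairExpr m

⟦_⟧ᵖ : PairExpr m → (Fin m → ℕ) → ℕ
⟦ pvar i ⟧ᵖ    ν = ν i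
⟦ pconst k ⟧ᵖ  ν = k
⟦ ppair a b ⟧ᵖ ν = pairᵒ (⟦ a ⟧ᵖ ν) (⟦ b ⟧ᵖ ν)

⟦⟧ᵖ-cong : (e : PairExpr m) {ν ν′ : Fin m → ℕ} → ν ≗ ν′ → ⟦ e ⟧ᵖ ν ≡ ⟦ e ⟧ᵖ ν′
⟦⟧ᵖ-cong (pvar i)    eq = eq i
⟦⟧ᵖ-cong (pconst k)  eq = refl
⟦⟧ᵖ-cong (ppair a b) eq = cong₂ pairᵒ (⟦⟧ᵖ-cong a eq) (⟦⟧ᵖ-cong b eq)

numeral-code : ℕ → ℕ
numeral-code k = codeT (num {0} k)

codeT-num : (k : ℕ) → codeT (num {n} k) ≡ numeral-code k
codeT-num zero    = refl
codeT-num (suc k) = cong (pair 2) (codeT-num k)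

¬ᵖ ∀ᵖ ∃ᵖ var₀≐ᵖ : PairExpr m → PairExpr m
¬ᵖ e     = ppair (pconst 8) (ppair e (ppair (pconst 7) (pconst 0)))
∀ᵖ e     = ppair (pconst 9) e
∃ᵖ e     = ¬ᵖ (∀ᵖ (¬ᵖ e))
var₀≐ᵖ e = ppair (pconst 5) (ppair (pconst (codeT (var {1} fz))) e)

_⇒ᵖ_ _∧ᵖ_ : PairExpr m → PairExpr m → PairExpr m
a ⇒ᵖ b = ppair (pconst 8) (ppair a b)
a ∧ᵖ b = ¬ᵖ (a ⇒ᵖ ¬ᵖ b)

module CodeTemplates (ν : Fin m → ℕ) where

  ¬ᵖ-code : (φ : Formula n) (e : PairExpr m) → code φ ≡ ⟦ e ⟧ᵖ ν → code (¬' φ) ≡ ⟦ ¬ᵖ e ⟧ᵖ ν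
  ¬ᵖ-code {n = n} φ e eq = trans (code-⇒ φ ⊥') (cong₂ (λ u v → pairᵒ 8 (pairᵒ u v)) eq (code-⊥ {n}))

  ⇒ᵖ-code : (φ ψ : Formula n) (a b : PairExpr m) → code φ ≡ ⟦ a ⟧ᵖ ν → code ψ ≡ ⟦ b ⟧ᵖ ν →
            code (φ ⇒ ψ) ≡ ⟦ a ⇒ᵖ b ⟧ᵖ ν
  ⇒ᵖ-code φ ψ a b eqᵃ eqᵇ = trans (code-⇒ φ ψ) (cong₂ (λ u v → pairᵒ 8 (pairᵒ u v)) eqᵃ eqᵇ)

  ∀ᵖ-code : (φ : Formula (suc n)) (e : PairExpr m) → code φ ≡ ⟦ e ⟧ᵖ ν → code (∀' φ) ≡ ⟦ ∀ᵖ e ⟧ᵖ ν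
  ∀ᵖ-code φ e eq = trans (code-∀ φ) (cong (pairᵒ 9) eq)

  ∃ᵖ-code : (φ : Formula (suc n)) (e : PairExpr m) → code φ ≡ ⟦ e ⟧ᵖ ν → code (∃' φ) ≡ ⟦ ∃ᵖ e ⟧ᵖ ν
  ∃ᵖ-code φ e eq = ¬ᵖ-code (∀' (¬' φ)) (∀ᵖ (¬ᵖ e)) (∀ᵖ-code (¬' φ) (¬ᵖ e) (¬ᵖ-code φ e eq))

  ∧ᵖ-code : (φ ψ : Formula n) (a b : PairExpr m) → code φ ≡ ⟦ a ⟧ᵖ ν → code ψ ≡ ⟦ b ⟧ᵖ ν →
            code (φ ∧' ψ) ≡ ⟦ a ∧ᵖ b ⟧ᵖ ν
  ∧ᵖ-code φ ψ a b eqᵃ eqᵇ = ¬ᵖ-code (φ ⇒ ¬' ψ) (a ⇒ᵖ ¬ᵖ b) (⇒ᵖ-code φ (¬' ψ) a (¬ᵖ b) eqᵃ (¬ᵖ-code ψ b eqᵇ))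

  var₀≐ᵖ-code : (k : ℕ) (e : PairExpr m) → numeral-code k ≡ ⟦ e ⟧ᵖ ν →
                code (var {suc n} fz ≐ num k) ≡ ⟦ var₀≐ᵖ e ⟧ᵖ ν
  var₀≐ᵖ-code k e eq =
    trans (code-≐ (var fz) (num k))
          (cong (λ v → pairᵒ 5 (pairᵒ (codeT (var {1} fz)) v)) (trans (codeT-num k) eq))

-- z = pair a b, stated as 2 z = (a + b)(a + b + 1) + 2 b since tri is not a term.
IsPair : Term n → Term n → Term n → Δ₀ n
IsPair a b z = num 2 *' z ≐₀ (a +' b) *' suc' (a +' b) +' num 2 *' b

-- The components of a pair are bounded by the pair, so they are quantified over below y.
IsValue : PairExpr m → (Fin m → Fin n) → Fin n → Δ₀ n
IsValue (pvar i)    ρ y = var y ≐₀ var (ρ i)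
IsValue (pconst k)  ρ y = var y ≐₀ num k
IsValue (ppair a b) ρ y = ∃≤ y (∃≤ (fs y)
  (IsPair (var (# 1)) (var (# 0)) (var (fs (fs y))) ∧₀
   IsValue a (fs ∘ fs ∘ ρ) (# 1) ∧₀
   IsValue b (fs ∘ fs ∘ ρ) (# 0)))

IsValue-sound : (e : PairExpr m) (ρ : Fin m → Fin n) (y : Fin n) (ν : Fin n → ℕ) →
                ν ⊨ IsValue e ρ y → ν y ≡ ⟦ e ⟧ᵖ (ν ∘ ρ)
IsValue-sound (pvar i)    ρ y ν y≡ = y≡
IsValue-sound (pconst k)  ρ y ν y≡ = trans y≡ (eval-num k ν)
IsValue-sound (ppair a b) ρ y ν (u , _ , v , _ , is-pair , is-a , is-b) = begin
  ν y                                  ≡⟨ pair-unique {u} {v} is-pair ⟩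
  pair u v                             ≡⟨ pairᵒ≡pair u v ⟨
  pairᵒ u v                            ≡⟨ cong₂ pairᵒ (IsValue-sound a _ _ _ is-a)
                                                       (IsValue-sound b _ _ _ is-b) ⟩
  pairᵒ (⟦ a ⟧ᵖ (ν ∘ ρ)) (⟦ b ⟧ᵖ (ν ∘ ρ)) ∎
  where open ≡-Reasoning

IsValue-complete : (e : PairExpr m) (ρ : Fin m → Fin n) (y : Fin n) (ν : Fin n → ℕ) →
                   ν y ≡ ⟦ e ⟧ᵖ (ν ∘ ρ) → ν ⊨ IsValue e ρ y
IsValue-complete (pvar i)    ρ y ν y≡ = y≡
IsValue-complete (pconst k)  ρ y ν y≡ = trans y≡ (sym (eval-num k ν))
IsValue-complete (ppair a b) ρ y ν y≡ =
  u , subst (u ≤_) (sym y≡′) (m≤pair u v) , v , subst (v ≤_) (sym y≡′) (n≤pair u v) ,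
  trans (cong (2 *_) y≡′) (pair-double u v) , IsValue-complete a _ _ _ refl , IsValue-complete b _ _ _ refl
  where
  u = ⟦ a ⟧ᵖ (ν ∘ ρ)
  v = ⟦ b ⟧ᵖ (ν ∘ ρ)
  y≡′ : ν y ≡ pair u v
  y≡′ = trans y≡ (pairᵒ≡pair u v)

-- r = β p q i: p = r + t m with r < m for the modulus m = 1 + (1 + i) q, where the quotient t ≤ p.
IsBeta : Fin n → Term n → Term n → Term n → Δ₀ n
IsBeta p q i r = ∃≤ p (var (fs p) ≐₀ renT fs r +' var fz *' renT fs modulus) ∧₀ ¬₀ (modulus ≤₀ r)
  where modulus = suc' (suc' i *' q)

module _ (p : Fin n) (q i r : Term n) (ν : Fin n → ℕ) where

  IsBeta-sound : ν ⊨ IsBeta p q i r → eval r ν ≡ β (ν p) (eval q ν) (eval i ν)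
  IsBeta-sound ((t , _ , p≡) , modulus≰r) = sym (%-unique t _ p≡r+tm (≰⇒> modulus≰r))
    where
    p≡r+tm : ν p ≡ eval r ν + t * β-modulus (eval q ν) (eval i ν)
    p≡r+tm = trans p≡ (cong₂ (λ a b → a + t * b) (eval-wk r t ν) (eval-wk (suc' (suc' i *' q)) t ν))

  IsBeta-complete : eval r ν ≡ β (ν p) (eval q ν) (eval i ν) → ν ⊨ IsBeta p q i r
  IsBeta-complete r≡ = (ν p / M , m/n≤m (ν p) M , p≡) , <⇒≱ r<M
    where
    M = β-modulus (eval q ν) (eval i ν)
    r<M : eval r ν < M
    r<M = subst (_< M) (sym r≡) (m%n<n (ν p) M)
    t = ν p / M
    p≡ : ν p ≡ eval (renT fs r) (t ∷ ν) + t * eval (renT fs (suc' (suc' i *' q))) (t ∷ ν)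
    p≡ = trans (m≡m%n+[m/n]*n (ν p) M)
      (cong₂ (λ a b → a + t * b) (trans (sym r≡) (sym (eval-wk r t ν)))
                                 (sym (eval-wk (suc' (suc' i *' q)) t ν)))

-- With variables (i , q , p , …): β p q (1 + i) = pair 2 (β p q i), both remainders being bounded by p.
NumeralStep : Δ₀ (3 + n)
NumeralStep = ∃≤ (# 2) (∃≤ (# 3)
  (IsBeta (# 4) (var (# 3)) (var (# 2)) (var (# 1)) ∧₀
   IsBeta (# 4) (var (# 3)) (suc' (var (# 2))) (var (# 0)) ∧₀
   IsPair (num 2) (var (# 1)) (var (# 0))))

-- c = numeral-code x, witnessed by β-codes p , q ≤ w of the sequence numeral-code 0 , … , numeral-code x.
IsNumeralCode : Fin n → Fin n → Fin n → Δ₀ n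
IsNumeralCode x c w = ∃≤ w (∃≤ (fs w) (starts ∧₀ steps ∧₀ ends))
  where
  starts = IsBeta (# 1) (var (# 0)) zero' (num 1)
  steps  = ∀≤ (fs (fs x)) (¬₀ (var (# 0) ≐₀ var (fs (fs (fs x)))) ⇒₀ NumeralStep)
  ends   = IsBeta (# 1) (var (# 0)) (var (fs (fs x))) (var (fs (fs c)))

IsNumeralCode-sound : (x c w : Fin n) (ν : Fin n → ℕ) → ν ⊨ IsNumeralCode x c w → ν c ≡ numeral-code (ν x)
IsNumeralCode-sound x c w ν (p , _ , q , _ , starts , steps , ends) =
  trans (IsBeta-sound (# 1) (var (# 0)) (var (fs (fs x))) (var (fs (fs c))) (q ∷ p ∷ ν) ends)
        (agree (ν x) ≤-refl)
  where
  agree : ∀ i → i ≤ ν x → β p q i ≡ numeral-code i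
  agree zero    _      = sym (IsBeta-sound (# 1) (var (# 0)) zero' (num 1) (q ∷ p ∷ ν) starts)
  agree (suc i) 1+i≤x with steps i (≤-trans (n≤1+n i) 1+i≤x) (λ i≡x → <-irrefl i≡x 1+i≤x)
  ... | r₁ , _ , r₂ , _ , is-r₁ , is-r₂ , is-pair = begin
    β p q (suc i)     ≡⟨ IsBeta-sound (# 4) (var (# 3)) (suc' (var (# 2))) (var (# 0)) ν₅ is-r₂ ⟨
    r₂                ≡⟨ pair-unique {2} {r₁} is-pair ⟩
    pair 2 r₁         ≡⟨ cong (pair 2) (IsBeta-sound (# 4) (var (# 3)) (var (# 2)) (var (# 1)) ν₅ is-r₁) ⟩
    pair 2 (β p q i)  ≡⟨ cong (pair 2) (agree i (≤-trans (n≤1+n i) 1+i≤x)) ⟩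
    numeral-code (suc i) ∎
    where
    open ≡-Reasoning
    ν₅ = r₂ ∷ r₁ ∷ i ∷ q ∷ p ∷ ν

IsNumeralCode-complete : (x c w : Fin n) (ν : Fin n → ℕ) {p q : ℕ} → p ≤ ν w → q ≤ ν w →
                         (∀ i → i ≤ ν x → β p q i ≡ numeral-code i) →
                         ν c ≡ numeral-code (ν x) → ν ⊨ IsNumeralCode x c w
IsNumeralCode-complete x c w ν {p} {q} p≤w q≤w agree c≡ =
  p , p≤w , q , q≤w ,
  IsBeta-complete (# 1) (var (# 0)) zero' (num 1) (q ∷ p ∷ ν) (sym (agree 0 z≤n)) ,
  steps ,
  IsBeta-complete (# 1) (var (# 0)) (var (fs (fs x))) (var (fs (fs c))) (q ∷ p ∷ ν)
    (trans c≡ (sym (agree (ν x) ≤-refl)))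
  where
  steps : ∀ i → i ≤ ν x → i ≢ ν x → i ∷ q ∷ p ∷ ν ⊨ NumeralStep
  steps i i≤x i≢x = r₁ , m%n≤m p _ , r₂ , m%n≤m p _ ,
    IsBeta-complete (# 4) (var (# 3)) (var (# 2)) (var (# 1)) ν₅ refl ,
    IsBeta-complete (# 4) (var (# 3)) (suc' (var (# 2))) (var (# 0)) ν₅ refl ,
    trans (cong (2 *_) r₂≡) (pair-double 2 r₁)
    where
    r₁ = β p q i
    r₂ = β p q (suc i)
    ν₅ = r₂ ∷ r₁ ∷ i ∷ q ∷ p ∷ ν
    r₂≡ : r₂ ≡ pair 2 r₁
    r₂≡ = trans (agree (suc i) (≤∧≢⇒< i≤x i≢x)) (cong (pair 2) (sym (agree i i≤x)))

module Encoding (Q : PairExpr 2) where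

  diagonal-code : ℕ → ℕ
  diagonal-code x = ⟦ Q ⟧ᵖ (numeral-code x ∷ x ∷ [])

  -- Variables (w , x , y): y = diagonal-code x, with every witness bounded by w.
  Encodes : Δ₀ 3
  Encodes = var (# 2) ≤₀ var (# 0) ∧₀
            ∃≤ (# 0) (IsValue Q (# 0 ∷ # 2 ∷ []) (# 3) ∧₀ IsNumeralCode (# 2) (# 0) (# 1))

  Encodes-sound : (ν : Fin 3 → ℕ) → ν ⊨ Encodes → ν (# 2) ≡ diagonal-code (ν (# 1))
  Encodes-sound ν (_ , c , _ , is-value , is-code) =
    trans (IsValue-sound Q _ _ _ is-value) (⟦⟧ᵖ-cong Q λ where
      fz      → IsNumeralCode-sound (# 2) (# 0) (# 1) (c ∷ ν) is-code
      (fs fz) → refl)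

  β-p β-q : ℕ → ℕ
  β-p x = proj₁ (β-lemma numeral-code x)
  β-q x = proj₁ (proj₂ (β-lemma numeral-code x))

  β-pq-correct : ∀ x i → i ≤ x → β (β-p x) (β-q x) i ≡ numeral-code i
  β-pq-correct x = proj₂ (proj₂ (β-lemma numeral-code x))

  witness-bound : ℕ → ℕ
  witness-bound x = diagonal-code x + numeral-code x + β-p x + β-q x

  diagonal-code≤witness-bound : ∀ x → diagonal-code x ≤ witness-bound x
  diagonal-code≤witness-bound x = m≤m+n+o+p (diagonal-code x) _ _ _
    where
    m≤m+n+o+p : ∀ m n o p → m ≤ m + n + o + p
    m≤m+n+o+p m n o p = ≤-trans (≤-trans (m≤m+n m n) (m≤m+n _ o)) (m≤m+n _ p)

  Encodes-complete : (ν : Fin 3 → ℕ) → ν (# 2) ≡ diagonal-code (ν (# 1)) → witness-bound (ν (# 1)) ≤ ν (# 0) →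
                     ν ⊨ Encodes
  Encodes-complete ν y≡ bound≤w =
    subst (_≤ w) (sym y≡) (bounded (diagonal-code≤witness-bound x)) , c , bounded c≤bound ,
    IsValue-complete Q (# 0 ∷ # 2 ∷ []) (# 3) (c ∷ ν) (trans y≡ (⟦⟧ᵖ-cong Q λ { fz → refl ; (fs fz) → refl })) ,
    IsNumeralCode-complete (# 2) (# 0) (# 1) (c ∷ ν) (bounded p≤bound) (bounded q≤bound) (β-pq-correct x) refl
    where
    x = ν (# 1)
    w = ν (# 0)
    c = numeral-code x
    y = diagonal-code x
    p = β-p x
    q = β-q x
    bounded : ∀ {a} → a ≤ witness-bound x → a ≤ w
    bounded a≤bound = ≤-trans a≤bound bound≤w
    c≤bound : c ≤ witness-bound x
    c≤bound = ≤-trans (≤-trans (m≤n+m c y) (m≤m+n (y + c) p)) (m≤m+n (y + c + p) q)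
    p≤bound : p ≤ witness-bound x
    p≤bound = ≤-trans (m≤n+m p (y + c)) (m≤m+n (y + c + p) q)
    q≤bound : q ≤ witness-bound x
    q≤bound = m≤n+m q (y + c + p)

  -- Variables (b , x , y): every y′ ≤ w′ ≤ b that Encodes (w′ , x , y′) equals y.
  OnlyEncoding : Δ₀ 3
  OnlyEncoding = ∀≤ (# 0) (∀≤ (# 0) (rename₀ (# 1 ∷ # 3 ∷ # 0 ∷ []) Encodes ⇒₀ var (# 0) ≐₀ var (# 4)))

  OnlyEncoding-true : (ν : Fin 3 → ℕ) → ν (# 2) ≡ diagonal-code (ν (# 1)) → ν ⊨ OnlyEncoding
  OnlyEncoding-true ν y≡ w′ _ y′ _ encodes = trans (Encodes-sound _ encodes) (sym y≡)

  EncodesUniquely : Δ₀ 3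
  EncodesUniquely = Encodes ∧₀ OnlyEncoding

  EncodesUniquely-complete : (ν : Fin 3 → ℕ) → ν (# 2) ≡ diagonal-code (ν (# 1)) →
                             witness-bound (ν (# 1)) ≤ ν (# 0) → ν ⊨ EncodesUniquely
  EncodesUniquely-complete ν y≡ bound≤w = Encodes-complete ν y≡ bound≤w , OnlyEncoding-true ν y≡

-- The diagonal lemma

module Diagonal (T : Theory) (R⊆T : Extends T R) (χ : Formula 1) where

  open NaturalDeduction T
  open Equality T
  open Robinson T R⊆T
  open Δ₀-Completeness T R⊆T

  private variable
    Γ : Ctx m

  -- Q (c , x) is the code of θ when c = numeral-code z and x = z = code G.
  Aᵖ Hᵖ Q : PairExpr 2
  Aᵖ = var₀≐ᵖ (pvar (# 0))
  Hᵖ = ∃ᵖ (Aᵖ ∧ᵖ pvar (# 1))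
  Q  = ∃ᵖ (Hᵖ ∧ᵖ pconst (code χ))

  open Encoding Q

  -- G, H and θ are opaque so that their Gödel numbers are never computed.
  opaque
    G : Formula 2
    G = ∃' ⌊ EncodesUniquely ⌋

  z : ℕ
  z = code G

  A : Formula 2
  A = var fz ≐ num z

  opaque
    H : Formula 1
    H = ∃' (A ∧' G)

  opaque
    θ : Sentence
    θ = ∃' (H ∧' χ)

  N W : ℕ
  N = code θ
  W = witness-bound z

  opaque
    unfolding G
    G-def : G ≡ ∃' ⌊ EncodesUniquely ⌋
    G-def = refl

  opaque
    unfolding H
    H-def : H ≡ ∃' (A ∧' G)
    H-def = refl

  opaque
    unfolding θ
    θ-def : θ ≡ ∃' (H ∧' χ)
    θ-def = refl

  -- All implicit arguments are explicit: solving a metavariable by the code of a concrete formula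
  -- makes the typechecker evaluate the Cantor pairing symbolically.
  code-θ : N ≡ diagonal-code z
  code-θ = trans {i = code θ} {j = code (∃' (H ∧' χ))} {k = ⟦ Q ⟧ᵖ ν}
    (cong (code {0}) {θ} {∃' (H ∧' χ)} θ-def)
    (∃ᵖ-code (H ∧' χ) (Hᵖ ∧ᵖ pconst (code χ)) (∧ᵖ-code H χ Hᵖ (pconst (code χ)) code-H refl))
    where
    ν = numeral-code z ∷ z ∷ []
    open CodeTemplates ν
    code-H : code H ≡ ⟦ Hᵖ ⟧ᵖ ν
    code-H = trans {i = code H} {j = code (∃' (A ∧' G))} {k = ⟦ Hᵖ ⟧ᵖ ν}
      (cong (code {1}) {H} {∃' (A ∧' G)} H-def)
      (∃ᵖ-code (A ∧' G) (Aᵖ ∧ᵖ pvar (# 1)) (∧ᵖ-code A G Aᵖ (pvar (# 1)) (var₀≐ᵖ-code z (pvar (# 0)) refl) refl))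

  only-encoding-elim : (b x y w′ y′ : Term m) → Γ ⊩ sub (b ∷ x ∷ y ∷ []) ⌊ OnlyEncoding ⌋ →
                       Γ ⊩ w′ ≤' b → Γ ⊩ y′ ≤' w′ → Γ ⊩ sub (w′ ∷ x ∷ y′ ∷ []) ⌊ Encodes ⌋ → Γ ⊩ y′ ≐ y
  only-encoding-elim {Γ = Γ} b x y w′ y′ only w′≤b y′≤w′ encodes =
    ⇒E (∀≤-elim (w′ ∷ σ) (# 0) body y′ (∀≤-elim σ (# 0) (∀≤ (# 0) body) w′ only w′≤b) y′≤w′)
       (subst (Γ ⊩_) (sym (trans (sub-ren τ ρ ⌊ Encodes ⌋) (sub-cong τ∘ρ≗ ⌊ Encodes ⌋))) encodes)
    where
    σ = b ∷ x ∷ y ∷ []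
    τ = y′ ∷ w′ ∷ σ
    ρ : Fin 3 → Fin 5
    ρ = # 1 ∷ # 3 ∷ # 0 ∷ []
    body = rename₀ ρ Encodes ⇒₀ var (# 0) ≐₀ var (# 4)
    τ∘ρ≗ : (λ i → τ (ρ i)) ≗ w′ ∷ x ∷ y′ ∷ []
    τ∘ρ≗ fz           = refl
    τ∘ρ≗ (fs fz)      = refl
    τ∘ρ≗ (fs (fs fz)) = refl

  encodes-θ : Γ ⊩ sub (num W ∷ num z ∷ num N ∷ []) ⌊ EncodesUniquely ⌋
  encodes-θ {Γ = Γ} = subst (Γ ⊩_) (sub-cong numerals ⌊ EncodesUniquely ⌋)
    (Δ₀-complete EncodesUniquely (W ∷ z ∷ N ∷ []) (EncodesUniquely-complete (W ∷ z ∷ N ∷ []) code-θ ≤-refl))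
    where
    numerals : (λ i → num ((W ∷ z ∷ N ∷ []) i)) ≗ num W ∷ num z ∷ num N ∷ []
    numerals fz           = refl
    numerals (fs fz)      = refl
    numerals (fs (fs fz)) = refl

  -- Compare w with W: below W the true closed instance of OnlyEncoding applies, above W the hypothesis.
  encoding-unique : (w y : Term m) → Γ ⊩ sub (w ∷ num z ∷ y ∷ []) ⌊ EncodesUniquely ⌋ → Γ ⊩ y ≐ num N
  encoding-unique w y d = ∨E (≤'-total w W)
    (only-encoding-elim (num W) (num z) (num N) w y
       (∧E₂ encodes-θ) hyp₀ (∧E₁ (∧E₁ (weaken d))) (∧E₁ (weaken d)))
    (≐-sym (only-encoding-elim w (num z) y (num W) (num N)
       (∧E₂ (weaken d)) hyp₀ (∧E₁ (∧E₁ encodes-θ)) (∧E₁ encodes-θ)))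

  G-at-z-unique : ε ▹ sub (num z ∷ var (# 1) ∷ []) G ⊩ var (# 1) ≐ num N
  G-at-z-unique =
    subst (λ φ → ε ▹ φ ⊩ var (# 1) ≐ num N) (sym (cong (sub γ) G-def)) (∃E (subst (ε ▹ E ⊩_) wk-goal unique))
    where
    γ : Fin 2 → Term 2
    γ = num z ∷ var (# 1) ∷ []
    E = sub (liftSub γ) ⌊ EncodesUniquely ⌋
    lifted : liftSub γ ≗ var (# 0) ∷ num z ∷ var (# 2) ∷ []
    lifted fz           = refl
    lifted (fs fz)      = renT-num fs z
    lifted (fs (fs fz)) = refl
    unique : ε ▹ E ⊩ var (# 2) ≐ num N
    unique = encoding-unique (var (# 0)) (var (# 2))
               (subst (ε ▹ E ⊩_) (sub-cong lifted ⌊ EncodesUniquely ⌋) hyp₀)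
    wk-goal : (var (# 2) ≐ num N) ≡ wk (var (# 1) ≐ num N)
    wk-goal = cong (var (# 2) ≐_) (sym (renT-num fs N))

  H-unique : ε ▹ H ⊩ var fz ≐ num N
  H-unique = subst (λ φ → ε ▹ φ ⊩ var fz ≐ num N) (sym H-def)
    (∃E (subst (ε ▹ A ∧' G ⊩_) wk-goal (⇒E′ (close (⇒I G-at-z-unique)) G-at-z)))
    where
    κ : Fin 2 → Term 3
    κ = var (# 0) ∷ var (# 2) ∷ []
    at-var : subT (single (var fz)) ∘ κ ≗ var
    at-var fz      = refl
    at-var (fs fz) = refl
    at-z : subT (single (num z)) ∘ κ ≗ num z ∷ var (# 1) ∷ []
    at-z fz      = refl
    at-z (fs fz) = refl
    G-at-z : ε ▹ A ∧' G ⊩ sub (num z ∷ var (# 1) ∷ []) G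
    G-at-z = ≐-subst (sub κ G)
      (trans (sub-sub (single (var fz)) κ G) (trans (sub-cong at-var G) (sub-var G)))
      (trans (sub-sub (single (num z)) κ G) (sub-cong at-z G))
      (∧E₁ hyp₀) (∧E₂ hyp₀)
    wk-goal : (var (# 1) ≐ num N) ≡ wk (var fz ≐ num N)
    wk-goal = cong (var (# 1) ≐_) (sym (renT-num fs N))

  H-holds : ε ⊩ H [ num N ]
  H-holds = subst (λ φ → ε ⊩ φ [ num N ]) (sym H-def)
    (∃I (num z) (subst (ε ⊩_) (sym (sub-liftSub-single (single (num N)) (num z) (A ∧' G)))
      (∧I (subst (λ t → ε ⊩ num z ≐ t) (sym (subT-num σ z)) ≐-refl) G-holds)))
    where
    σ : Fin 2 → Term 0
    σ = num z ∷ single (num N)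
    numerals : num W ∷ σ ≗ num W ∷ num z ∷ num N ∷ []
    numerals fz           = refl
    numerals (fs fz)      = refl
    numerals (fs (fs fz)) = refl
    G-holds : ε ⊩ sub σ G
    G-holds = subst (λ φ → ε ⊩ sub σ φ) (sym G-def)
      (∃I (num W) (subst (ε ⊩_) (sym (trans (sub-liftSub-single σ (num W) ⌊ EncodesUniquely ⌋)
                                            (sub-cong numerals ⌊ EncodesUniquely ⌋)))
        encodes-θ))

  θ⇒χ : T ⊢ θ ⇒ χ [ num N ]
  θ⇒χ = subst (λ φ → T ⊢ φ ⇒ χ [ num N ]) (sym θ-def)
    (close (⇒I (∃E (subst (ε ▹ H ∧' χ ⊩_) wk-instance (≐-subst-const χ y≐N χ-at-y)))))
    where
    y≐N : ε ▹ H ∧' χ ⊩ var fz ≐ num N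
    y≐N = ⇒E′ (close (⇒I H-unique)) (∧E₁ hyp₀)
    χ-at-y : ε ▹ H ∧' χ ⊩ sub (const (var fz)) χ
    χ-at-y = subst (ε ▹ H ∧' χ ⊩_) (sym (sub-const-var χ)) (∧E₂ hyp₀)
    wk-instance : sub (const (num N)) χ ≡ wk (χ [ num N ])
    wk-instance = sym (trans (ren-sub fs (single (num N)) χ) (sub-cong (λ { fz → renT-num fs N }) χ))

  χ⇒θ : T ⊢ χ [ num N ] ⇒ θ
  χ⇒θ = subst (λ φ → T ⊢ χ [ num N ] ⇒ φ) (sym θ-def)
    (close (⇒I (∃I (num N) (∧I (lift (close H-holds)) hyp₀))))

FixedPoint : Theory → Formula 1 → Set
FixedPoint T χ = Σ Sentence λ θ → (T ⊢ θ ⇒ χ [ ⌜ θ ⌝ ]) × (T ⊢ χ [ ⌜ θ ⌝ ] ⇒ θ)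

diagonal-lemma : (T : Theory) → Extends T R → (χ : Formula 1) → FixedPoint T χ
diagonal-lemma T R⊆T χ = θ , θ⇒χ , χ⇒θ
  where open Diagonal T R⊆T χ

⊕-axiom : {φ : Sentence} → T ⊕ φ ⊢ φ
⊕-axiom {T = T} {φ = φ} = subst (T ⊕ φ ⊢_) (embed-sentence φ) (ax (inj₂ refl))

⊕-refute : {φ : Sentence} → T ⊕ φ ⊢ ⊥' → T ⊢ ¬' φ
⊕-refute {T = T} {φ = φ} d = subst (λ χ → T ⊢ χ ⇒ ⊥') (embed-sentence φ) (deduction d)

⊕⊕-inconsistent : {φ ψ : Sentence} → T ⊢ φ ⇒ ¬' ψ → T ⊕ φ ⊕ ψ ⊢ ⊥'
⊕⊕-inconsistent φ⇒¬ψ = mp (mp (⊢-mono (inj₁ ∘ inj₁) φ⇒¬ψ) (⊢-mono inj₁ ⊕-axiom)) ⊕-axiom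

refutable : {φ ψ : Sentence} → (Consistent (T ⊕ φ) → Consistent (T ⊕ φ ⊕ ψ)) → T ⊢ φ ⇒ ¬' ψ →
            ¬ ¬ (T ⊢ ¬' φ)
refutable keeps-consistent φ⇒¬ψ ⊬¬φ = keeps-consistent (⊬¬φ ∘ ⊕-refute) (⊕⊕-inconsistent φ⇒¬ψ)

mainTheorem3 : (U : Theory) → Extends U R → Consistent U →
  ¬ (Σ (Formula 1) λ ρ →
      ((φ : Sentence) → Consistent (U ⊕ φ) →
          Consistent (U ⊕ φ ⊕ ρ [ ⌜ φ ⌝ ]) × Consistent (U ⊕ φ ⊕ ¬' (ρ [ ⌜ φ ⌝ ])))
    × ((φ ψ : Sentence) → (U ⊢ φ ⇔ ψ) → (U ⊢ ρ [ ⌜ φ ⌝ ] ⇔ ρ [ ⌜ ψ ⌝ ])))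
mainTheorem3 U R⊆U U-consistent (ρ , independent , extensional) =
  contradiction (diagonal-lemma U R⊆U (¬' ρ)) (diagonal-lemma U R⊆U ρ)
  where
  open NaturalDeduction U
  contradiction : FixedPoint U (¬' ρ) → FixedPoint U ρ → ⊥
  contradiction (θ₁ , θ₁⇒¬ρ , ¬ρ⇒θ₁) (θ₂ , θ₂⇒ρ , ρ⇒θ₂) =
    refutable (proj₁ ∘ independent θ₁) θ₁⇒¬ρ λ ⊢¬θ₁ →
    refutable (proj₂ ∘ independent θ₂) (close (⇒I (¬¬I (⇒E′ θ₂⇒ρ hyp₀)))) λ ⊢¬θ₂ →
    U-consistent (close (⇒E (lift ⊢¬θ₂) (⇒E′ ρ⇒θ₂ (⇒E (∧E₁ (lift (ρ₁⇔ρ₂ ⊢¬θ₁ ⊢¬θ₂))) (ρ₁ ⊢¬θ₁)))))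
    where
    ρ₁ : U ⊢ ¬' θ₁ → ε ⊩ ρ [ ⌜ θ₁ ⌝ ]
    ρ₁ ⊢¬θ₁ = raa (⇒E (lift ⊢¬θ₁) (⇒E′ ¬ρ⇒θ₁ hyp₀))
    ρ₁⇔ρ₂ : U ⊢ ¬' θ₁ → U ⊢ ¬' θ₂ → U ⊢ ρ [ ⌜ θ₁ ⌝ ] ⇔ ρ [ ⌜ θ₂ ⌝ ]
    ρ₁⇔ρ₂ ⊢¬θ₁ ⊢¬θ₂ = extensional θ₁ θ₂ (close (⇔-refuted (lift ⊢¬θ₁) (lift ⊢¬θ₂)))
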